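{- With the notation of the context, the word $v_{3,m+2}v_{3,m+1}\dots v_{3,1}$ produced by the three passes is the Ostrowski representation of $M+N$ (up to leading zeros); that is, $M+N=\sum_{i=1}^{m+2}v_{3,i}\,q_{i-1}$, $v_{3,1}<a_1$, $v_{3,i}\le a_i$ for all $i$, and $v_{3,i-1}=0$ whenever $v_{3,i}=a_i$.
   Context: Let $a$ be a real number with infinite continued fraction expansion $[a_0;a_1,a_2,\dots]$ ($a_0\in\mathbb{Z}$, $a_i$ positive integers for $i\ge1$). Set $q_{ -1}=0$, $q_0=1$, $q_{k+1}=a_{k+1}q_k+q_{k-1}$. The Ostrowski representation of $N\in\mathbb{N}$ is the unique word $b_n\dots b_1$ with $N=\sum_{k=0}^{n}b_{k+1}q_k$, $b_k\in\mathbb{N}$, $b_1<a_1$, $b_k\le a_k$, and $b_{k-1}=0$ whenever $b_k=a_k$. A word is written $u_r\dots u_1$; $u_i$ is the entry at position $i$ (weight $q_{i-1}$). Let $M,N\in\mathbb{N}$ have Ostrowski representations $x_n\dots x_1$, $y_n\dots y_1$ (padded with leading zeros to common length $n$). Let $m=n+1$, $s_i=x_i+y_i$ ($1\le i\le n$), $s_m=0$, $s=s_m\dots s_1$. Algorithm 1 (left-to-right) defines $z_k=z_{k,m}\dots z_{k,1}$ for $k=m+1,\dots,3$ (decreasing). $z_{m+1}=s$. For $4\le k\le m$: $z_{k,i}=z_{k+1,i}$ for $i\notin\{k,k-1,k-2,k-3\}$, and (A1) if $z_{k+1,k}<a_k$, $z_{k+1,k-1}>a_{k-1}$, $z_{k+1,k-2}=0$: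 $(z_{k,k},z_{k,k-1},z_{k,k-2},z_{k,k-3})=(z_{k+1,k}+1,\ z_{k+1,k-1}-(a_{k-1}+1),\ a_{k-2}-1,\ z_{k+1,k-3}+1)$; (A2) if $z_{k+1,k}<a_k$, $a_{k-1}\le z_{k+1,k-1}\le 2a_{k-1}$, $z_{k+1,k-2}>0$: $(z_{k+1,k}+1,\ z_{k+1,k-1}-a_{k-1},\ z_{k+1,k-2}-1,\ z_{k+1,k-3})$; (A3) otherwise unchanged. For $k=3$: $z_{3,i}=z_{4,i}$ for $i\notin\{1,2,3\}$, and (B1) if $z_{4,3}<a_3$, $z_{4,2}>a_2$, $z_{4,1}=0$: $(z_{3,3},z_{3,2},z_{3,1})=(z_{4,3}+1,\ z_{4,2}-(a_2+1),\ a_1-1)$; (B2) if $z_{4,3}<a_3$, $z_{4,2}\ge a_2$, $a_1\ge z_{4,1}>0$: $(z_{4,3}+1,\ z_{4,2}-a_2,\ z_{4,1}-1)$; (B3) if $z_{4,3}<a_3$, $z_{4,2}\ge a_2$, $z_{4,1}>a_1$: $(z_{4,3}+1,\ z_{4,2}-a_2+1,\ z_{4,1}-a_1-1)$; (B4) if $z_{4,2}<a_2$, $z_{4,1}\ge a_1$: $(z_{4,3},\ z_{4,2}+1,\ z_{4,1}-a_1)$; (B5) otherwise unchanged. Algorithm 2 (right-to-left) defines $w_k=w_{k,m+1}\dots w_{k,1}$ for $k=2,\dots,m+1$ (increasing). $w_2=0\,z_{3,m}\dots z_{3,1}$. For $3\le k\le m+1$: $w_{k,i}=w_{k-1,i}$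 for $i\notin\{k,k-1,k-2\}$; if $w_{k-1,k}<a_k$, $w_{k-1,k-1}=a_{k-1}$, $w_{k-1,k-2}>0$, then $(w_{k,k},w_{k,k-1},w_{k,k-2})=(w_{k-1,k}+1,\ 0,\ w_{k-1,k-2}-1)$; otherwise unchanged. Algorithm 3 (left-to-right) defines $v_k=v_{k,m+2}\dots v_{k,1}$ for $k=m+3,m+2,\dots,3$ (decreasing). $v_{m+3}=0\,w_{m+1,m+1}\dots w_{m+1,1}$. For $3\le k\le m+2$: $v_{k,i}=v_{k+1,i}$ for $i\notin\{k,k-1,k-2\}$; if $v_{k+1,k}<a_k$, $v_{k+1,k-1}=a_{k-1}$, $v_{k+1,k-2}>0$, then $(v_{k,k},v_{k,k-1},v_{k,k-2})=(v_{k+1,k}+1,\ 0,\ v_{k+1,k-2}-1)$; otherwise unchanged. -}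

module Defs where

open import Data.Nat.Base
open import Data.Bool.Base using (Bool; true; false; if_then_else_; _∧_)
open import Data.Product using (_×_)
open import Relation.Binary.PropositionalEquality using (_≡_)

-- A word u_r … u_1 is a function ℕ → ℕ; u i is the entry at position i
-- (position 0 is never used).  Only positions 1 … r are meaningful.
Word : Set
Word = ℕ → ℕ

-- Partial quotients: a i = a_i for i ≥ 1 (a 0 is unused; a_0 plays no role).
-- Q a i = q_{i-1}, the weight of position i:  Q a 0 = q_{-1} = 0,
-- Q a 1 = q_0 = 1,  q_{k+1} = a_{k+1} q_k + q_{k-1}.
Q : (ℕ → ℕ) → ℕ → ℕ
Q a zero = 0
Q a (suc zero) = 1
Q a (suc (suc k)) = a (suc k) * Q a (suc k) + Q a k

val : (ℕ → ℕ) → ℕ → Word → ℕ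
val a zero u = 0
val a (suc r) u = val a r u + u (suc r) * Q a (suc r)

IsOstrowski : (ℕ → ℕ) → ℕ → Word → Set
IsOstrowski a r u =
  (1 ≤ r → u 1 < a 1) ×
  ((i : ℕ) → 1 ≤ i → i ≤ r → u i ≤ a i) ×
  ((i : ℕ) → 2 ≤ i → i ≤ r → u i ≡ a i → u (i ∸ 1) ≡ 0)

upd : Word → ℕ → ℕ → Word
upd f i v j = if j ≡ᵇ i then v else f j

trunc : ℕ → Word → Word
trunc r f j = if (1 ≤ᵇ j) ∧ (j ≤ᵇ r) then f j else 0

sumWord : ℕ → Word → Word → Word
sumWord n x y = trunc n (λ i → x i + y i)

-- Algorithm 1, step k ≥ 4 : z_{k+1} ↦ z_k
stepA : (ℕ → ℕ) → ℕ → Word → Word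
stepA a k z =
  if (z k <ᵇ a k) ∧ (a (k ∸ 1) <ᵇ z (k ∸ 1)) ∧ (z (k ∸ 2) ≡ᵇ 0)
  then upd (upd (upd (upd z k (z k + 1))
                               (k ∸ 1) (z (k ∸ 1) ∸ (a (k ∸ 1) + 1)))
                               (k ∸ 2) (a (k ∸ 2) ∸ 1))
                               (k ∸ 3) (z (k ∸ 3) + 1)
  else
  (if (z k <ᵇ a k) ∧ (a (k ∸ 1) ≤ᵇ z (k ∸ 1)) ∧ (z (k ∸ 1) ≤ᵇ 2 * a (k ∸ 1))
        ∧ (1 ≤ᵇ z (k ∸ 2))
   then upd (upd (upd z k (z k + 1))
                         (k ∸ 1) (z (k ∸ 1) ∸ a (k ∸ 1)))
                         (k ∸ 2) (z (k ∸ 2) ∸ 1)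
   else z)

-- Algorithm 1, step k = 3 : z_4 ↦ z_3
stepB : (ℕ → ℕ) → Word → Word
stepB a z =
  if (z 3 <ᵇ a 3) ∧ (a 2 <ᵇ z 2) ∧ (z 1 ≡ᵇ 0)
  then upd (upd (upd z 3 (z 3 + 1)) 2 (z 2 ∸ (a 2 + 1))) 1 (a 1 ∸ 1)
  else (if (z 3 <ᵇ a 3) ∧ (a 2 ≤ᵇ z 2) ∧ (1 ≤ᵇ z 1) ∧ (z 1 ≤ᵇ a 1)
  then upd (upd (upd z 3 (z 3 + 1)) 2 (z 2 ∸ a 2)) 1 (z 1 ∸ 1)
  else (if (z 3 <ᵇ a 3) ∧ (a 2 ≤ᵇ z 2) ∧ (a 1 <ᵇ z 1)
  then upd (upd (upd z 3 (z 3 + 1)) 2 ((z 2 ∸ a 2) + 1)) 1 (z 1 ∸ (a 1 + 1))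
  else (if (z 2 <ᵇ a 2) ∧ (a 1 ≤ᵇ z 1)
  then upd (upd z 2 (z 2 + 1)) 1 (z 1 ∸ a 1)
  else z)))

alg1From : (ℕ → ℕ) → ℕ → Word → Word
alg1From a (suc (suc (suc (suc k)))) z = alg1From a (suc (suc (suc k))) (stepA a (suc (suc (suc (suc k)))) z)
alg1From a (suc (suc (suc zero))) z = stepB a z
alg1From a _ z = z

-- step of Algorithms 2 and 3 at index k ≥ 3
stepC : (ℕ → ℕ) → ℕ → Word → Word
stepC a k w =
  if (w k <ᵇ a k) ∧ (w (k ∸ 1) ≡ᵇ a (k ∸ 1)) ∧ (1 ≤ᵇ w (k ∸ 2))
  then upd (upd (upd w k (w k + 1)) (k ∸ 1) 0) (k ∸ 2) (w (k ∸ 2) ∸ 1)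
  else w

runUp : (ℕ → ℕ) → ℕ → Word → Word
runUp a (suc (suc (suc k))) w = stepC a (suc (suc (suc k))) (runUp a (suc (suc k)) w)
runUp a _ w = w

runDown : (ℕ → ℕ) → ℕ → Word → Word
runDown a (suc (suc (suc k))) v = runDown a (suc (suc k)) (stepC a (suc (suc (suc k))) v)
runDown a _ v = v

-- z_3 (with m = n + 1)
z3 : (ℕ → ℕ) → ℕ → Word → Word → Word
z3 a n x y = alg1From a (suc n) (sumWord n x y)

-- w_{m+1}, starting from w_2 = 0 z_{3,m} … z_{3,1}
wFinal : (ℕ → ℕ) → ℕ → Word → Word → Word
wFinal a n x y = runUp a (suc (suc n)) (trunc (suc n) (z3 a n x y))

-- v_3, starting from v_{m+3} = 0 w_{m+1,m+1} … w_{m+1,1}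
v3 : (ℕ → ℕ) → ℕ → Word → Word → Word
v3 a n x y = runDown a (suc (suc (suc n))) (trunc (suc (suc n)) (wFinal a n x y))

module Submission where

-- v₃ arises from the digitwise sum s of x and y by three passes of local
-- steps, each rewriting a window of two to four adjacent positions.
-- * Value.  Each step is an instance of the recurrence
--   q_k = a_k q_{k-1} + q_{k-2}, so it preserves  val a r w = Σ w_i q_{i-1};
--   since val is additive, val v₃ = val x + val y = M + N.
-- * Digit conditions.
--   Algorithm 1 turns s, whose digits are at most 2a_i with the constraints
--   inherited from x and y, into a word with digits at most a_i and first
--   digit below a_1.  Algorithm 2 keeps these bounds and removes every
--   "valley" a_{k+1} 0 a_{k-1} c with c > 0.  Algorithm 3, running downwards,
--   then removes every digit a_i followed by a nonzero digit, which is the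
--   last Ostrowski condition.

open import Defs
open import Data.Nat.Base using (ℕ; suc; _≤_; _+_)
open import Data.Product using (_×_)
open import Relation.Binary.PropositionalEquality using (_≡_)
open import Data.Nat.Base
open import Data.Nat.Properties
open import Data.Nat.Tactic.RingSolver using (solve-∀)
open import Data.Bool.Base using (if_then_else_)
open import Data.Empty using (⊥-elim)
open import Data.Product using (_,_; proj₁; proj₂; uncurry)
open import Data.Sum using (_⊎_; inj₁; inj₂)
open import Relation.Nullary using (¬_; yes; no)
open import Relation.Nullary.Reflects using (Reflects; ofʸ; ofⁿ; fromEquivalence; _×-reflects_)
open import Algebra.Properties.CommutativeSemigroup +-commutativeSemigroup
  using (xy∙z≈xz∙y; x∙yz≈xz∙y)
open import Relation.Binary.PropositionalEquality
  using (_≢_; refl; sym; trans; cong; cong₂; subst; subst₂; module ≡-Reasoning)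

≡ᵇ-reflects-≡ : ∀ m n → Reflects (m ≡ n) (m ≡ᵇ n)
≡ᵇ-reflects-≡ m n = fromEquivalence (≡ᵇ⇒≡ m n) (≡⇒≡ᵇ m n)

if-cases : ∀ {P : Set} {b} {A R : Set} {x y : A} → Reflects P b →
  (P → (if b then x else y) ≡ x → R) → (¬ P → (if b then x else y) ≡ y → R) → R
if-cases (ofʸ p)  then-case else-case = then-case p refl
if-cases (ofⁿ ¬p) then-case else-case = else-case ¬p refl

upd-same : ∀ f i v → upd f i v i ≡ v
upd-same f i v with i ≡ᵇ i | ≡ᵇ-reflects-≡ i i
... | _ | ofʸ _  = refl
... | _ | ofⁿ ¬p = ⊥-elim (¬p refl)

upd-other : ∀ f i v j → j ≢ i → upd f i v j ≡ f j
upd-other f i v j j≢i with j ≡ᵇ i | ≡ᵇ-reflects-≡ j i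
... | _ | ofʸ p = ⊥-elim (j≢i p)
... | _ | ofⁿ _ = refl

-- Simultaneous update of a window of two, three or four adjacent
-- positions, listed from the top; the lowest position is q.  The steps of
-- the three algorithms are exactly such window updates.
upd₂ : Word → ℕ → ℕ → ℕ → Word
upd₂ f q v₁ v₀ = upd (upd f (suc q) v₁) q v₀

upd₃ : Word → ℕ → ℕ → ℕ → ℕ → Word
upd₃ f q v₂ v₁ v₀ = upd (upd₂ f (suc q) v₂ v₁) q v₀

upd₄ : Word → ℕ → ℕ → ℕ → ℕ → ℕ → Word
upd₄ f q v₃ v₂ v₁ v₀ = upd (upd₃ f (suc q) v₃ v₂ v₁) q v₀

below≢ : ∀ {i q} → i < q → ∀ e → i ≢ e + q
below≢ {i} {q} i<q e = <⇒≢ (<-≤-trans i<q (m≤n+m q e))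

above≢ : ∀ {i q} d → d + q < i → ∀ e → e ≤ d → i ≢ e + q
above≢ {i} {q} d d+q<i e e≤d = >⇒≢ (≤-<-trans (+-monoˡ-≤ q e≤d) d+q<i)

upd₂-at₁ : ∀ f q v₁ v₀ → upd₂ f q v₁ v₀ (suc q) ≡ v₁
upd₂-at₁ f q v₁ v₀ =
  trans (upd-other (upd f (suc q) v₁) q v₀ (suc q) (above≢ 0 ≤-refl 0 z≤n)) (upd-same f (suc q) v₁)

upd₂-at₀ : ∀ f q v₁ v₀ → upd₂ f q v₁ v₀ q ≡ v₀
upd₂-at₀ f q v₁ v₀ = upd-same (upd f (suc q) v₁) q v₀

upd₂-out : ∀ f q v₁ v₀ i → i ≢ q → i ≢ suc q → upd₂ f q v₁ v₀ i ≡ f i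
upd₂-out f q v₁ v₀ i i≢q i≢q+1 =
  trans (upd-other (upd f (suc q) v₁) q v₀ i i≢q) (upd-other f (suc q) v₁ i i≢q+1)

upd₂-below : ∀ f q v₁ v₀ i → i < q → upd₂ f q v₁ v₀ i ≡ f i
upd₂-below f q v₁ v₀ i i<q = upd₂-out f q v₁ v₀ i (below≢ i<q 0) (below≢ i<q 1)

upd₃-at₂ : ∀ f q v₂ v₁ v₀ → upd₃ f q v₂ v₁ v₀ (2 + q) ≡ v₂
upd₃-at₂ f q v₂ v₁ v₀ =
  trans (upd-other (upd₂ f (suc q) v₂ v₁) q v₀ (2 + q) (above≢ 1 ≤-refl 0 z≤n))
        (upd₂-at₁ f (suc q) v₂ v₁)

upd₃-at₁ : ∀ f q v₂ v₁ v₀ → upd₃ f q v₂ v₁ v₀ (1 + q) ≡ v₁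
upd₃-at₁ f q v₂ v₁ v₀ =
  trans (upd-other (upd₂ f (suc q) v₂ v₁) q v₀ (1 + q) (above≢ 0 ≤-refl 0 z≤n))
        (upd₂-at₀ f (suc q) v₂ v₁)

upd₃-at₀ : ∀ f q v₂ v₁ v₀ → upd₃ f q v₂ v₁ v₀ q ≡ v₀
upd₃-at₀ f q v₂ v₁ v₀ = upd-same (upd₂ f (suc q) v₂ v₁) q v₀

upd₃-out : ∀ f q v₂ v₁ v₀ i → i ≢ q → i ≢ 1 + q → i ≢ 2 + q → upd₃ f q v₂ v₁ v₀ i ≡ f i
upd₃-out f q v₂ v₁ v₀ i ne₀ ne₁ ne₂ =
  trans (upd-other (upd₂ f (suc q) v₂ v₁) q v₀ i ne₀) (upd₂-out f (suc q) v₂ v₁ i ne₁ ne₂)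

upd₃-below : ∀ f q v₂ v₁ v₀ i → i < q → upd₃ f q v₂ v₁ v₀ i ≡ f i
upd₃-below f q v₂ v₁ v₀ i i<q = upd₃-out f q v₂ v₁ v₀ i (below≢ i<q 0) (below≢ i<q 1) (below≢ i<q 2)

upd₃-above : ∀ f q v₂ v₁ v₀ i → 2 + q < i → upd₃ f q v₂ v₁ v₀ i ≡ f i
upd₃-above f q v₂ v₁ v₀ i h =
  upd₃-out f q v₂ v₁ v₀ i (above≢ 2 h 0 z≤n) (above≢ 2 h 1 (s≤s z≤n)) (above≢ 2 h 2 ≤-refl)

upd₃-cases : ∀ f q v₂ v₁ v₀ i →
  i ≡ 2 + q ⊎ i ≡ 1 + q ⊎ i ≡ q ⊎ upd₃ f q v₂ v₁ v₀ i ≡ f i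
upd₃-cases f q v₂ v₁ v₀ i with i ≟ q | i ≟ 1 + q | i ≟ 2 + q
... | yes e | _     | _     = inj₂ (inj₂ (inj₁ e))
... | no _  | yes e | _     = inj₂ (inj₁ e)
... | no _  | no _  | yes e = inj₁ e
... | no n₀ | no n₁ | no n₂ = inj₂ (inj₂ (inj₂ (upd₃-out f q v₂ v₁ v₀ i n₀ n₁ n₂)))

upd₄-at₃ : ∀ f q v₃ v₂ v₁ v₀ → upd₄ f q v₃ v₂ v₁ v₀ (3 + q) ≡ v₃
upd₄-at₃ f q v₃ v₂ v₁ v₀ =
  trans (upd-other (upd₃ f (suc q) v₃ v₂ v₁) q v₀ (3 + q) (above≢ 2 ≤-refl 0 z≤n))
        (upd₃-at₂ f (suc q) v₃ v₂ v₁)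

upd₄-at₂ : ∀ f q v₃ v₂ v₁ v₀ → upd₄ f q v₃ v₂ v₁ v₀ (2 + q) ≡ v₂
upd₄-at₂ f q v₃ v₂ v₁ v₀ =
  trans (upd-other (upd₃ f (suc q) v₃ v₂ v₁) q v₀ (2 + q) (above≢ 1 ≤-refl 0 z≤n))
        (upd₃-at₁ f (suc q) v₃ v₂ v₁)

upd₄-at₁ : ∀ f q v₃ v₂ v₁ v₀ → upd₄ f q v₃ v₂ v₁ v₀ (1 + q) ≡ v₁
upd₄-at₁ f q v₃ v₂ v₁ v₀ =
  trans (upd-other (upd₃ f (suc q) v₃ v₂ v₁) q v₀ (1 + q) (above≢ 0 ≤-refl 0 z≤n))
        (upd₃-at₀ f (suc q) v₃ v₂ v₁)

upd₄-at₀ : ∀ f q v₃ v₂ v₁ v₀ → upd₄ f q v₃ v₂ v₁ v₀ q ≡ v₀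
upd₄-at₀ f q v₃ v₂ v₁ v₀ = upd-same (upd₃ f (suc q) v₃ v₂ v₁) q v₀

upd₄-below : ∀ f q v₃ v₂ v₁ v₀ i → i < q → upd₄ f q v₃ v₂ v₁ v₀ i ≡ f i
upd₄-below f q v₃ v₂ v₁ v₀ i i<q =
  trans (upd-other (upd₃ f (suc q) v₃ v₂ v₁) q v₀ i (below≢ i<q 0))
        (upd₃-below f (suc q) v₃ v₂ v₁ i (<-trans i<q (n<1+n q)))

upd₄-above : ∀ f q v₃ v₂ v₁ v₀ i → 3 + q < i → upd₄ f q v₃ v₂ v₁ v₀ i ≡ f i
upd₄-above f q v₃ v₂ v₁ v₀ i h =
  trans (upd-other (upd₃ f (suc q) v₃ v₂ v₁) q v₀ i (above≢ 3 h 0 z≤n))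
        (upd₃-above f (suc q) v₃ v₂ v₁ i (subst (_< i) (sym (+-suc 2 q)) h))

trunc-in : ∀ r f j → 1 ≤ j → j ≤ r → trunc r f j ≡ f j
trunc-in r f (suc j) _ j≤r with suc j ≤ᵇ r | ≤ᵇ-reflects-≤ (suc j) r
... | _ | ofʸ _  = refl
... | _ | ofⁿ ¬p = ⊥-elim (¬p j≤r)

trunc-out : ∀ r f j → r < j → trunc r f j ≡ 0
trunc-out r f zero _ = refl
trunc-out r f (suc j) r<j with suc j ≤ᵇ r | ≤ᵇ-reflects-≤ (suc j) r
... | _ | ofʸ p = ⊥-elim (<⇒≱ r<j p)
... | _ | ofⁿ _ = refl

-- Compensated exchanges compose; this accounts for a window update as a
-- sequence of single-position updates.
+-telescope : ∀ G G′ F X X′ Y Y′ → G + X ≡ G′ + Y → G′ + X′ ≡ F + Y′ →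
  G + (X′ + X) ≡ F + (Y′ + Y)
+-telescope G G′ F X X′ Y Y′ e e′ = begin
  G + (X′ + X)   ≡⟨ x∙yz≈xz∙y G X′ X ⟩
  (G + X) + X′   ≡⟨ cong (_+ X′) e ⟩
  (G′ + Y) + X′  ≡⟨ xy∙z≈xz∙y G′ Y X′ ⟩
  (G′ + X′) + Y  ≡⟨ cong (_+ Y) e′ ⟩
  (F + Y′) + Y   ≡⟨ +-assoc F Y′ Y ⟩
  F + (Y′ + Y)   ∎
  where open ≡-Reasoning

module Value (a : ℕ → ℕ) where

  val-cong : ∀ r f g → (∀ i → 1 ≤ i → i ≤ r → f i ≡ g i) → val a r f ≡ val a r g
  val-cong zero    f g _   = refl
  val-cong (suc r) f g f≗g =
    cong₂ _+_ (val-cong r f g (λ i 1≤i i≤r → f≗g i 1≤i (m≤n⇒m≤1+n i≤r)))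
              (cong (_* Q a (suc r)) (f≗g (suc r) (s≤s z≤n) ≤-refl))

  val-upd : ∀ r f i v → 1 ≤ i → i ≤ r →
    val a r (upd f i v) + f i * Q a i ≡ val a r f + v * Q a i
  val-upd zero    f (suc i) v _   ()
  val-upd (suc r) f i       v 1≤i i≤1+r with m≤n⇒m<n∨m≡n i≤1+r
  ... | inj₂ refl = begin
    (val a r (upd f i v) + upd f i v i * Q a i) + f i * Q a i
      ≡⟨ cong₂ (λ g u → (g + u * Q a i) + f i * Q a i)
           (val-cong r _ _ (λ j _ j≤r → upd-other f i v j (<⇒≢ (s≤s j≤r)))) (upd-same f i v) ⟩
    (val a r f + v * Q a i) + f i * Q a i
      ≡⟨ xy∙z≈xz∙y (val a r f) (v * Q a i) (f i * Q a i) ⟩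
    (val a r f + f i * Q a i) + v * Q a i
      ∎
    where open ≡-Reasoning
  ... | inj₁ i<1+r = begin
    (val a r (upd f i v) + upd f i v (suc r) * Q a (suc r)) + f i * Q a i
      ≡⟨ cong (λ u → (val a r (upd f i v) + u * Q a (suc r)) + f i * Q a i)
           (upd-other f i v (suc r) (>⇒≢ i<1+r)) ⟩
    (val a r (upd f i v) + top) + f i * Q a i
      ≡⟨ xy∙z≈xz∙y (val a r (upd f i v)) top (f i * Q a i) ⟩
    (val a r (upd f i v) + f i * Q a i) + top
      ≡⟨ cong (_+ top) (val-upd r f i v 1≤i (≤-pred i<1+r)) ⟩
    (val a r f + v * Q a i) + top
      ≡⟨ xy∙z≈xz∙y (val a r f) (v * Q a i) top ⟩
    (val a r f + top) + v * Q a i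
      ∎
    where
    open ≡-Reasoning
    top : ℕ
    top = f (suc r) * Q a (suc r)

  val-upd′ : ∀ r f i v o → f i ≡ o → 1 ≤ i → i ≤ r →
    val a r (upd f i v) + o * Q a i ≡ val a r f + v * Q a i
  val-upd′ r f i v .(f i) refl = val-upd r f i v

  val-upd₂ : ∀ r f q v₁ v₀ → 1 ≤ q → 1 + q ≤ r →
    val a r (upd₂ f q v₁ v₀) + (f (1 + q) * Q a (1 + q) + f q * Q a q)
      ≡ val a r f + (v₁ * Q a (1 + q) + v₀ * Q a q)
  val-upd₂ r f q v₁ v₀ 1≤q q<r = +-telescope
    (val a r (upd₂ f q v₁ v₀)) (val a r (upd f (suc q) v₁)) (val a r f)
    (f q * Q a q) (f (1 + q) * Q a (1 + q)) (v₀ * Q a q) (v₁ * Q a (1 + q))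
    (val-upd′ r (upd f (suc q) v₁) q v₀ (f q) (upd-other f (suc q) v₁ q (<⇒≢ (n<1+n q))) 1≤q (<⇒≤ q<r))
    (val-upd r f (suc q) v₁ (s≤s z≤n) q<r)

  val-upd₃ : ∀ r f q v₂ v₁ v₀ → 1 ≤ q → 2 + q ≤ r →
    val a r (upd₃ f q v₂ v₁ v₀) + (f (2 + q) * Q a (2 + q) + f (1 + q) * Q a (1 + q) + f q * Q a q)
      ≡ val a r f + (v₂ * Q a (2 + q) + v₁ * Q a (1 + q) + v₀ * Q a q)
  val-upd₃ r f q v₂ v₁ v₀ 1≤q q+2≤r = +-telescope
    (val a r (upd₃ f q v₂ v₁ v₀)) (val a r (upd₂ f (suc q) v₂ v₁)) (val a r f)
    (f q * Q a q) (f (2 + q) * Q a (2 + q) + f (1 + q) * Q a (1 + q))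
    (v₀ * Q a q) (v₂ * Q a (2 + q) + v₁ * Q a (1 + q))
    (val-upd′ r (upd₂ f (suc q) v₂ v₁) q v₀ (f q) (upd₂-below f (suc q) v₂ v₁ q (n<1+n q)) 1≤q
      (≤-trans (m≤n+m q 2) q+2≤r))
    (val-upd₂ r f (suc q) v₂ v₁ (s≤s z≤n) q+2≤r)

  val-upd₄ : ∀ r f q v₃ v₂ v₁ v₀ → 1 ≤ q → 3 + q ≤ r →
    val a r (upd₄ f q v₃ v₂ v₁ v₀)
      + (f (3 + q) * Q a (3 + q) + f (2 + q) * Q a (2 + q) + f (1 + q) * Q a (1 + q) + f q * Q a q)
      ≡ val a r f + (v₃ * Q a (3 + q) + v₂ * Q a (2 + q) + v₁ * Q a (1 + q) + v₀ * Q a q)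
  val-upd₄ r f q v₃ v₂ v₁ v₀ 1≤q q+3≤r = +-telescope
    (val a r (upd₄ f q v₃ v₂ v₁ v₀)) (val a r (upd₃ f (suc q) v₃ v₂ v₁)) (val a r f)
    (f q * Q a q) (f (3 + q) * Q a (3 + q) + f (2 + q) * Q a (2 + q) + f (1 + q) * Q a (1 + q))
    (v₀ * Q a q) (v₃ * Q a (3 + q) + v₂ * Q a (2 + q) + v₁ * Q a (1 + q))
    (val-upd′ r (upd₃ f (suc q) v₃ v₂ v₁) q v₀ (f q) (upd₃-below f (suc q) v₃ v₂ v₁ q (n<1+n q)) 1≤q
      (≤-trans (m≤n+m q 3) q+3≤r))
    (val-upd₃ r f (suc q) v₃ v₂ v₁ (s≤s z≤n) q+3≤r)

  val-trunc : ∀ r d f → val a (d + r) (trunc r f) ≡ val a r f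
  val-trunc r zero    f = val-cong r _ _ (trunc-in r f)
  val-trunc r (suc d) f = begin
    val a (d + r) (trunc r f) + trunc r f (suc (d + r)) * Q a (suc (d + r))
      ≡⟨ cong (λ u → val a (d + r) (trunc r f) + u * Q a (suc (d + r)))
           (trunc-out r f (suc (d + r)) (s≤s (m≤n+m r d))) ⟩
    val a (d + r) (trunc r f) + 0
      ≡⟨ +-identityʳ _ ⟩
    val a (d + r) (trunc r f)
      ≡⟨ val-trunc r d f ⟩
    val a r f
      ∎
    where open ≡-Reasoning

  val-+ : ∀ r f g → val a r (λ i → f i + g i) ≡ val a r f + val a r g
  val-+ zero    f g = refl
  val-+ (suc r) f g = begin
    val a r (λ i → f i + g i) + (f (suc r) + g (suc r)) * Q a (suc r)
      ≡⟨ cong (_+ (f (suc r) + g (suc r)) * Q a (suc r)) (val-+ r f g) ⟩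
    val a r f + val a r g + (f (suc r) + g (suc r)) * Q a (suc r)
      ≡⟨ regroup (val a r f) (val a r g) (f (suc r)) (g (suc r)) (Q a (suc r)) ⟩
    val a r f + f (suc r) * Q a (suc r) + (val a r g + g (suc r) * Q a (suc r))
      ∎
    where
    open ≡-Reasoning
    regroup : ∀ F G x y q → F + G + (x + y) * q ≡ F + x * q + (G + y * q)
    regroup = solve-∀

module Steps (a : ℕ → ℕ) where

  CondC : ℕ → Word → Set
  CondC j w = w (3 + j) < a (3 + j) × w (2 + j) ≡ a (2 + j) × 1 ≤ w (1 + j)

  firedC : ℕ → Word → Word
  firedC j w = upd₃ w (1 + j) (w (3 + j) + 1) 0 (w (1 + j) ∸ 1)

  data StepCView (j : ℕ) (w : Word) : Set where
    fireC : CondC j w → stepC a (3 + j) w ≡ firedC j w → StepCView j w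
    idleC : ¬ CondC j w → stepC a (3 + j) w ≡ w → StepCView j w

  stepC-view : ∀ j w → StepCView j w
  stepC-view j w = if-cases
    (<ᵇ-reflects-< (w (3 + j)) (a (3 + j)) ×-reflects
     ≡ᵇ-reflects-≡ (w (2 + j)) (a (2 + j)) ×-reflects
     ≤ᵇ-reflects-≤ 1 (w (1 + j)))
    fireC idleC

  CondA1 CondA2 : ℕ → Word → Set
  CondA1 j z = z (4 + j) < a (4 + j) × a (3 + j) < z (3 + j) × z (2 + j) ≡ 0
  CondA2 j z = z (4 + j) < a (4 + j) × a (3 + j) ≤ z (3 + j) × z (3 + j) ≤ 2 * a (3 + j) × 1 ≤ z (2 + j)

  data StepAView (j : ℕ) (z : Word) : Set where
    fireA1 : CondA1 j z →
      stepA a (4 + j) z ≡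
        upd₄ z (1 + j) (z (4 + j) + 1) (z (3 + j) ∸ (a (3 + j) + 1)) (a (2 + j) ∸ 1) (z (1 + j) + 1) →
      StepAView j z
    fireA2 : CondA2 j z →
      stepA a (4 + j) z ≡ upd₃ z (2 + j) (z (4 + j) + 1) (z (3 + j) ∸ a (3 + j)) (z (2 + j) ∸ 1) →
      StepAView j z
    idleA : ¬ CondA1 j z → ¬ CondA2 j z → stepA a (4 + j) z ≡ z → StepAView j z

  stepA-view : ∀ j z → StepAView j z
  stepA-view j z =
    if-cases (<ᵇ-reflects-< (z (4 + j)) (a (4 + j)) ×-reflects
              <ᵇ-reflects-< (a (3 + j)) (z (3 + j)) ×-reflects
              ≡ᵇ-reflects-≡ (z (2 + j)) 0)
      fireA1 λ ¬c₁ e₁ →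
    if-cases (<ᵇ-reflects-< (z (4 + j)) (a (4 + j)) ×-reflects
              ≤ᵇ-reflects-≤ (a (3 + j)) (z (3 + j)) ×-reflects
              ≤ᵇ-reflects-≤ (z (3 + j)) (2 * a (3 + j)) ×-reflects
              ≤ᵇ-reflects-≤ 1 (z (2 + j)))
      (λ c₂ e₂ → fireA2 c₂ (trans e₁ e₂)) λ ¬c₂ e₂ →
    idleA ¬c₁ ¬c₂ (trans e₁ e₂)

  CondB1 CondB2 CondB3 CondB4 : Word → Set
  CondB1 z = z 3 < a 3 × a 2 < z 2 × z 1 ≡ 0
  CondB2 z = z 3 < a 3 × a 2 ≤ z 2 × 1 ≤ z 1 × z 1 ≤ a 1
  CondB3 z = z 3 < a 3 × a 2 ≤ z 2 × a 1 < z 1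
  CondB4 z = z 2 < a 2 × a 1 ≤ z 1

  data StepBView (z : Word) : Set where
    fireB1 : CondB1 z → stepB a z ≡ upd₃ z 1 (z 3 + 1) (z 2 ∸ (a 2 + 1)) (a 1 ∸ 1) → StepBView z
    fireB2 : CondB2 z → stepB a z ≡ upd₃ z 1 (z 3 + 1) (z 2 ∸ a 2) (z 1 ∸ 1) → StepBView z
    fireB3 : CondB3 z → stepB a z ≡ upd₃ z 1 (z 3 + 1) ((z 2 ∸ a 2) + 1) (z 1 ∸ (a 1 + 1)) → StepBView z
    fireB4 : CondB4 z → stepB a z ≡ upd₂ z 1 (z 2 + 1) (z 1 ∸ a 1) → StepBView z
    idleB  : ¬ CondB1 z → ¬ CondB2 z → ¬ CondB3 z → ¬ CondB4 z → stepB a z ≡ z → StepBView z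

  stepB-view : ∀ z → StepBView z
  stepB-view z =
    if-cases (<ᵇ-reflects-< (z 3) (a 3) ×-reflects <ᵇ-reflects-< (a 2) (z 2) ×-reflects
              ≡ᵇ-reflects-≡ (z 1) 0)
      fireB1 λ ¬c₁ e₁ →
    if-cases (<ᵇ-reflects-< (z 3) (a 3) ×-reflects ≤ᵇ-reflects-≤ (a 2) (z 2) ×-reflects
              ≤ᵇ-reflects-≤ 1 (z 1) ×-reflects ≤ᵇ-reflects-≤ (z 1) (a 1))
      (λ c₂ e₂ → fireB2 c₂ (trans e₁ e₂)) λ ¬c₂ e₂ →
    if-cases (<ᵇ-reflects-< (z 3) (a 3) ×-reflects ≤ᵇ-reflects-≤ (a 2) (z 2) ×-reflects
              <ᵇ-reflects-< (a 1) (z 1))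
      (λ c₃ e₃ → fireB3 c₃ (trans e₁ (trans e₂ e₃))) λ ¬c₃ e₃ →
    if-cases (<ᵇ-reflects-< (z 2) (a 2) ×-reflects ≤ᵇ-reflects-≤ (a 1) (z 1))
      (λ c₄ e₄ → fireB4 c₄ (trans e₁ (trans e₂ (trans e₃ e₄)))) λ ¬c₄ e₄ →
    idleB ¬c₁ ¬c₂ ¬c₃ ¬c₄ (trans e₁ (trans e₂ (trans e₃ e₄)))

-- In
-- each, T = A · R + S (and T′ = A′ · T + R) is an instance of the recurrence
-- q_{k} = a_{k} q_{k-1} + q_{k-2}; the left side is the contribution of the
-- window before the step, the right side after it.

-- (A2), (B2): a_{k-1} is moved from position k-1 to position k, using one
-- unit of position k-2.
stepA2-identity : ∀ W A R S f x → A ≤ f → 1 ≤ x →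
  W * (A * R + S) + f * R + x * S ≡ (W + 1) * (A * R + S) + (f ∸ A) * R + (x ∸ 1) * S
stepA2-identity W A R S f (suc x) A≤f _ with m≤n⇒∃[o]m+o≡n A≤f
... | d , refl rewrite m+n∸m≡n A d = identity W A R S d x
  where
  identity : ∀ W A R S d x →
    W * (A * R + S) + (A + d) * R + suc x * S ≡ (W + 1) * (A * R + S) + d * R + x * S
  identity = solve-∀

stepC-identity : ∀ W A R S f x → f ≡ A → 1 ≤ x →
  W * (A * R + S) + f * R + x * S ≡ (W + 1) * (A * R + S) + 0 * R + (x ∸ 1) * S
stepC-identity W A R S .A x refl 1≤x =
  subst (λ d → W * (A * R + S) + A * R + x * S ≡ (W + 1) * (A * R + S) + d * R + (x ∸ 1) * S)
        (n∸n≡0 A) (stepA2-identity W A R S A x ≤-refl 1≤x)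

-- (A1): as (A2), borrowing the missing unit of position k-2 from
-- position k-1 (position k-2 becomes a_{k-2} - 1 and position k-3 gains one).
stepA1-identity : ∀ W A′ A R S f′ f x → A′ < f′ → f ≡ 0 → 1 ≤ A →
  W * (A′ * (A * R + S) + R) + f′ * (A * R + S) + f * R + x * S
    ≡ (W + 1) * (A′ * (A * R + S) + R) + (f′ ∸ (A′ + 1)) * (A * R + S) + (A ∸ 1) * R + (x + 1) * S
stepA1-identity W A′ (suc A) R S f′ .0 x A′<f′ refl _ with m≤n⇒∃[o]m+o≡n A′<f′
... | d , refl rewrite +-comm A′ 1 | m+n∸m≡n (suc A′) d = identity W A′ A R S d x
  where
  identity : ∀ W A′ A R S d x →
    W * (A′ * (suc A * R + S) + R) + (suc A′ + d) * (suc A * R + S) + 0 * R + x * S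
      ≡ (W + 1) * (A′ * (suc A * R + S) + R) + d * (suc A * R + S) + A * R + (x + 1) * S
  identity = solve-∀

-- (B1): (A1) at the bottom of the word, where q₀ = 1 and q_{-1} = 0.
stepB1-identity : ∀ W A′ A f′ f → A′ < f′ → f ≡ 0 → 1 ≤ A →
  W * (A′ * (A * 1 + 0) + 1) + f′ * (A * 1 + 0) + f * 1
    ≡ (W + 1) * (A′ * (A * 1 + 0) + 1) + (f′ ∸ (A′ + 1)) * (A * 1 + 0) + (A ∸ 1) * 1
stepB1-identity W A′ (suc A) f′ .0 A′<f′ refl _ with m≤n⇒∃[o]m+o≡n A′<f′
... | d , refl rewrite +-comm A′ 1 | m+n∸m≡n (suc A′) d = identity W A′ A d
  where
  identity : ∀ W A′ A d →
    W * (A′ * (suc A * 1 + 0) + 1) + (suc A′ + d) * (suc A * 1 + 0) + 0 * 1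
      ≡ (W + 1) * (A′ * (suc A * 1 + 0) + 1) + d * (suc A * 1 + 0) + A * 1
  identity = solve-∀

-- (B3): two carries at once, from position 2 to 3 and from position 1 to 2.
stepB3-identity : ∀ W A′ A f′ f → A′ ≤ f′ → A < f →
  W * (A′ * (A * 1 + 0) + 1) + f′ * (A * 1 + 0) + f * 1
    ≡ (W + 1) * (A′ * (A * 1 + 0) + 1) + ((f′ ∸ A′) + 1) * (A * 1 + 0) + (f ∸ (A + 1)) * 1
stepB3-identity W A′ A f′ f A′≤f′ A<f with m≤n⇒∃[o]m+o≡n A′≤f′ | m≤n⇒∃[o]m+o≡n A<f
... | d , refl | e , refl rewrite m+n∸m≡n A′ d | +-comm A 1 | m+n∸m≡n (suc A) e = identity W A′ A d e
  where
  identity : ∀ W A′ A d e →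
    W * (A′ * (A * 1 + 0) + 1) + (A′ + d) * (A * 1 + 0) + (suc A + e) * 1
      ≡ (W + 1) * (A′ * (A * 1 + 0) + 1) + (d + 1) * (A * 1 + 0) + e * 1
  identity = solve-∀

-- (B4): a carry from position 1 to position 2.
stepB4-identity : ∀ W A f → A ≤ f → W * (A * 1 + 0) + f * 1 ≡ (W + 1) * (A * 1 + 0) + (f ∸ A) * 1
stepB4-identity W A f A≤f with m≤n⇒∃[o]m+o≡n A≤f
... | d , refl rewrite m+n∸m≡n A d = identity W A d
  where
  identity : ∀ W A d → W * (A * 1 + 0) + (A + d) * 1 ≡ (W + 1) * (A * 1 + 0) + d * 1
  identity = solve-∀

trade-balanced : ∀ {U V X Y} → U + X ≡ V + Y → X ≡ Y → U ≡ V
trade-balanced {U} {V} {X} e X≡Y = +-cancelʳ-≡ X U V (trans e (cong (V +_) (sym X≡Y)))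

module ValuePreservation (a : ℕ → ℕ) (a-pos : ∀ i → 1 ≤ i → 1 ≤ a i) where
  open Value a
  open Steps a

  stepC-val : ∀ r j w → 3 + j ≤ r → val a r (stepC a (3 + j) w) ≡ val a r w
  stepC-val r j w hr with stepC-view j w
  ... | idleC _ e rewrite e = refl
  ... | fireC (_ , c₂ , c₃) e rewrite e =
    trade-balanced (val-upd₃ r w (1 + j) (w (3 + j) + 1) 0 (w (1 + j) ∸ 1) (s≤s z≤n) hr)
    (stepC-identity (w (3 + j)) (a (2 + j)) (Q a (2 + j)) (Q a (1 + j)) (w (2 + j)) (w (1 + j)) c₂ c₃)

  stepA-val : ∀ r j z → 4 + j ≤ r → val a r (stepA a (4 + j) z) ≡ val a r z
  stepA-val r j z hr with stepA-view j z
  ... | idleA _ _ e rewrite e = refl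
  ... | fireA1 (_ , c₂ , c₃) e rewrite e = trade-balanced (val-upd₄ r z (1 + j) _ _ _ _ (s≤s z≤n) hr)
    (stepA1-identity (z (4 + j)) (a (3 + j)) (a (2 + j)) (Q a (2 + j)) (Q a (1 + j))
                     (z (3 + j)) (z (2 + j)) (z (1 + j)) c₂ c₃ (a-pos (2 + j) (s≤s z≤n)))
  ... | fireA2 (_ , c₂ , _ , c₄) e rewrite e = trade-balanced (val-upd₃ r z (2 + j) _ _ _ (s≤s z≤n) hr)
    (stepA2-identity (z (4 + j)) (a (3 + j)) (Q a (3 + j)) (Q a (2 + j)) (z (3 + j)) (z (2 + j)) c₂ c₄)

  stepB-val : ∀ r z → 3 ≤ r → val a r (stepB a z) ≡ val a r z
  stepB-val r z hr with stepB-view z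
  ... | idleB _ _ _ _ e rewrite e = refl
  ... | fireB1 (_ , c₂ , c₃) e rewrite e = trade-balanced (val-upd₃ r z 1 _ _ _ (s≤s z≤n) hr)
    (stepB1-identity (z 3) (a 2) (a 1) (z 2) (z 1) c₂ c₃ (a-pos 1 (s≤s z≤n)))
  ... | fireB2 (_ , c₂ , c₃ , _) e rewrite e = trade-balanced (val-upd₃ r z 1 _ _ _ (s≤s z≤n) hr)
    (stepA2-identity (z 3) (a 2) (Q a 2) (Q a 1) (z 2) (z 1) c₂ c₃)
  ... | fireB3 (_ , c₂ , c₃) e rewrite e = trade-balanced (val-upd₃ r z 1 _ _ _ (s≤s z≤n) hr)
    (stepB3-identity (z 3) (a 2) (a 1) (z 2) (z 1) c₂ c₃)
  ... | fireB4 (_ , c₂) e rewrite e = trade-balanced (val-upd₂ r z 1 _ _ (s≤s z≤n) (≤-trans (n≤1+n 2) hr))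
    (stepB4-identity (z 2) (a 1) (z 1) c₂)

  alg1-val : ∀ r j z → 3 + j ≤ r → val a r (alg1From a (3 + j) z) ≡ val a r z
  alg1-val r zero    z hr = stepB-val r z hr
  alg1-val r (suc j) z hr = trans (alg1-val r j _ (≤-trans (n≤1+n _) hr)) (stepA-val r j z hr)

  runUp-val : ∀ r j w → 2 + j ≤ r → val a r (runUp a (2 + j) w) ≡ val a r w
  runUp-val r zero    w hr = refl
  runUp-val r (suc j) w hr = trans (stepC-val r j _ hr) (runUp-val r j w (≤-trans (n≤1+n _) hr))

  runDown-val : ∀ r j w → 2 + j ≤ r → val a r (runDown a (2 + j) w) ≡ val a r w
  runDown-val r zero    w hr = refl
  runDown-val r (suc j) w hr = trans (runDown-val r j _ (≤-trans (n≤1+n _) hr)) (stepC-val r j w hr)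

2*-double : ∀ A → 2 * A ≡ A + A
2*-double A = cong (A +_) (+-identityʳ A)

<⇒+1≤ : ∀ {x A} → x < A → x + 1 ≤ A
<⇒+1≤ {x} {A} x<A = subst (_≤ A) (+-comm 1 x) x<A

∸1-< : ∀ {y b} → 1 ≤ y → y ≤ b → y ∸ 1 < b
∸1-< {suc y} _ y<b = y<b

≤-suc-≢ : ∀ {y X} → y ≤ suc X → y ≢ suc X → y ≤ X
≤-suc-≢ y≤1+X y≢1+X = ≤-pred (≤∧≢⇒< y≤1+X y≢1+X)

∸-half-≤ : ∀ {x A} → x ≤ 2 * A → x ∸ A ≤ A
∸-half-≤ {x} {A} x≤2A =
  subst (x ∸ A ≤_) (trans (cong (_∸ A) (2*-double A)) (m+n∸m≡n A A)) (∸-monoˡ-≤ A x≤2A)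

∸-half-suc-≤ : ∀ {x A} → x ≤ suc (2 * A) → x ∸ (A + 1) ≤ A
∸-half-suc-≤ {x} {A} x≤1+2A = subst (x ∸ (A + 1) ≤_) eq (∸-monoˡ-≤ (A + 1) x≤1+2A)
  where
  split : ∀ A → suc (2 * A) ≡ (A + 1) + A
  split = solve-∀
  eq : suc (2 * A) ∸ (A + 1) ≡ A
  eq = trans (cong (_∸ (A + 1)) (split A)) (m+n∸m≡n (A + 1) A)

∸-half-< : ∀ {x A} → A ≤ x → x < 2 * A → x ∸ A < A
∸-half-< {x} {A} A≤x x<2A =
  subst (x ∸ A <_) (trans (cong (_∸ A) (2*-double A)) (m+n∸m≡n A A)) (∸-monoˡ-< x<2A A≤x)

∸-half-suc-< : ∀ {x A} → A < x → x < 2 * A → x ∸ (A + 1) < A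
∸-half-suc-< {x} {A} A<x x<2A = ≤-<-trans (∸-monoʳ-≤ x (m≤m+n A 1)) (∸-half-< (<⇒≤ A<x) x<2A)

∸-half-≡ : ∀ {x A} → A ≤ x → x ∸ A ≡ A → x ≡ 2 * A
∸-half-≡ {x} {A} A≤x e = trans (sym (m+[n∸m]≡n A≤x)) (trans (cong (A +_) e) (sym (2*-double A)))

sum-max : ∀ {x y A} → x ≤ A → y ≤ A → x + y ≡ 2 * A → x ≡ A × y ≡ A
sum-max {x} {y} {A} x≤A y≤A e =
  ≤-antisym x≤A (+-cancelʳ-≤ A A x AA≤xA) , ≤-antisym y≤A (+-cancelˡ-≤ A A y AA≤Ay)
  where
  AA≡xy : A + A ≡ x + y
  AA≡xy = trans (sym (2*-double A)) (sym e)
  AA≤xA : A + A ≤ x + A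
  AA≤xA = subst (_≤ x + A) (sym AA≡xy) (+-monoʳ-≤ x y≤A)
  AA≤Ay : A + A ≤ A + y
  AA≤Ay = subst (_≤ A + y) (sym AA≡xy) (+-monoˡ-≤ y x≤A)

sum-near-max : ∀ {x y A} → x ≤ A → y ≤ A → 2 * A ≤ suc (x + y) → x ≡ A ⊎ y ≡ A
sum-near-max {x} {y} {A} x≤A y≤A h with x ≟ A | y ≟ A
... | yes e  | _     = inj₁ e
... | no _   | yes e = inj₂ e
... | no x≢A | no y≢A = ⊥-elim (<⇒≱ lt h)
  where
  lt : suc (x + y) < 2 * A
  lt = subst (suc (suc (x + y)) ≤_) (sym (2*-double A))
         (subst (_≤ A + A) (cong suc (+-suc x y)) (+-mono-≤ (≤∧≢⇒< x≤A x≢A) (≤∧≢⇒< y≤A y≢A)))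

≥-cases : ∀ q i → q ≤ i → i ≡ q ⊎ i ≡ 1 + q ⊎ i ≡ 2 + q ⊎ 3 + q ≤ i
≥-cases q i q≤i with m≤n⇒∃[o]m+o≡n q≤i
... | 0 , e = inj₁ (trans (sym e) (+-identityʳ q))
... | 1 , e = inj₂ (inj₁ (trans (sym e) (+-comm q 1)))
... | 2 , e = inj₂ (inj₂ (inj₁ (trans (sym e) (+-comm q 2))))
... | suc (suc (suc d)) , e =
  inj₂ (inj₂ (inj₂ (subst (3 + q ≤_) (trans (+-comm (3 + d) q) e) (s≤s (s≤s (s≤s (m≤n+m q d)))))))

window-cases : ∀ j k → j ≤ k → k ≤ 3 + j → k ≡ j ⊎ k ≡ 1 + j ⊎ k ≡ 2 + j ⊎ k ≡ 3 + j
window-cases j k j≤k k≤3+j with ≥-cases j k j≤k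
... | inj₁ e = inj₁ e
... | inj₂ (inj₁ e) = inj₂ (inj₁ e)
... | inj₂ (inj₂ (inj₁ e)) = inj₂ (inj₂ (inj₁ e))
... | inj₂ (inj₂ (inj₂ 3+j≤k)) = inj₂ (inj₂ (inj₂ (≤-antisym k≤3+j 3+j≤k)))

-- PairBound y u A A′: y is a digit in a position with bound A which may
-- exceed A by at most A + 1 (the slack left by the digitwise sum and one
-- incoming carry), and the predecessor digit u (bound A′) is controlled at
-- the two extreme values of y.
PairBound : ℕ → ℕ → ℕ → ℕ → Set
PairBound y u A A′ = y ≤ suc (2 * A) × (y ≡ suc (2 * A) → u ≡ 0) × (y ≡ 2 * A → u ≤ A′)

pairBound-sum : ∀ {y u A A′} → y ≤ 2 * A → (y ≡ 2 * A → u ≡ 0) → PairBound y u A A′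
pairBound-sum y≤2A y≡2A⇒u≡0 =
  m≤n⇒m≤1+n y≤2A ,
  (λ e → ⊥-elim (<⇒≱ (n<1+n _) (subst (_≤ _) e y≤2A))) ,
  (λ e → subst (_≤ _) (sym (y≡2A⇒u≡0 e)) z≤n)

pairBound-sum+1 : ∀ {y u A A′} → y ≤ 2 * A → (y ≡ 2 * A → u ≡ 0) → (2 * A ≤ suc y → u ≤ A′) →
  PairBound (y + 1) u A A′
pairBound-sum+1 {y} y≤2A y≡2A⇒u≡0 near⇒u≤A′ rewrite +-comm y 1 =
  s≤s y≤2A , (λ e → y≡2A⇒u≡0 (suc-injective e)) , (λ e → near⇒u≤A′ (subst (_≤ suc y) e ≤-refl))

pairBound-small : ∀ {y u A A′} → y ≤ A → 1 ≤ A → PairBound y u A A′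
pairBound-small {y} {u} {A} y≤A 1≤A =
  ≤-trans y≤A (m≤n⇒m≤1+n (m≤m+n A _)) ,
  (λ e → ⊥-elim (<⇒≱ (s≤s (m≤m+n A (A + 0))) (subst (_≤ A) e y≤A))) ,
  (λ e → ⊥-elim (<⇒≱ A<2A (subst (_≤ A) e y≤A)))
  where
  A<2A : A < 2 * A
  A<2A = subst (A <_) (sym (2*-double A)) (subst (_< A + A) (+-identityʳ A) (+-monoʳ-< A 1≤A))

pairBound-pred : ∀ {y u A A′} → PairBound y u A A′ → 1 ≤ y → PairBound (y ∸ 1) u A A′
pairBound-pred {suc y} {u} {A} (y<1+2A , top⇒u≡0 , _) _ =
  <⇒≤ y<1+2A ,
  (λ e → ⊥-elim (<-irrefl refl (subst (λ t → suc t ≤ suc (2 * A)) e y<1+2A))) ,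
  (λ e → subst (_≤ _) (sym (top⇒u≡0 (cong suc e))) z≤n)

module Bounds (a : ℕ → ℕ) where

  BoundedUpTo : ℕ → Word → Set
  BoundedUpTo r w = (∀ i → 1 ≤ i → i ≤ r → w i ≤ a i) × w 1 < a 1

  Bounded : Word → Set
  Bounded w = (∀ i → 1 ≤ i → w i ≤ a i) × w 1 < a 1

  bounded-upTo : ∀ r w → Bounded w → BoundedUpTo r w
  bounded-upTo r w (w≤a , w₁<a₁) = (λ i 1≤i _ → w≤a i 1≤i) , w₁<a₁

  trunc-bounded : ∀ r w → 1 ≤ r → BoundedUpTo r w → Bounded (trunc r w)
  trunc-bounded r w 1≤r (w≤a , w₁<a₁) = trunc≤a , subst (_< a 1) (sym (trunc-in r w 1 ≤-refl 1≤r)) w₁<a₁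
    where
    trunc≤a : ∀ i → 1 ≤ i → trunc r w i ≤ a i
    trunc≤a i 1≤i with i ≤? r
    ... | yes i≤r = subst (_≤ a i) (sym (trunc-in r w i 1≤i i≤r)) (w≤a i 1≤i i≤r)
    ... | no  i≰r = subst (_≤ a i) (sym (trunc-out r w i (≰⇒> i≰r))) z≤n

-- Algorithm 1 runs on s = z_{m+1}; before step K it has produced z_{K+1}.
module Pass1 (a : ℕ → ℕ) (a-pos : ∀ i → 1 ≤ i → 1 ≤ a i) (s : Word) (m : ℕ) where
  open Steps a
  open Bounds a

  -- What a digitwise sum of two Ostrowski words of length < m satisfies.
  record SumConditions : Set where
    field
      bounded₂ : ∀ i → s i ≤ 2 * a i
      double⇒pred-zero : ∀ i → 2 ≤ i → s i ≡ 2 * a i → s (i ∸ 1) ≡ 0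
      near-double⇒pred-bounded : ∀ i → 2 ≤ i → 2 * a i ≤ suc (s i) → s (i ∸ 1) ≤ a (i ∸ 1)
      first-slack : 2 + s 1 ≤ 2 * a 1
      top-zero : s m ≡ 0

  PairBoundAt : Word → ℕ → Set
  PairBoundAt Z i = PairBound (Z i) (Z (i ∸ 1)) (a i) (a (i ∸ 1))

  record Invariant (K : ℕ) (Z : Word) : Set where
    field
      normalised : ∀ i → K < i → i ≤ m → Z i ≤ a i
      at-K : Z K ≤ a K
      at-K-max : Z K ≡ a K → Z (K ∸ 1) < a (K ∸ 1)
      at-K-1 : PairBoundAt Z (K ∸ 1)
      at-K-2 : 2 ≤ K ∸ 2 → PairBoundAt Z (K ∸ 2)
      untouched : ∀ i → i ≤ K ∸ 3 → Z i ≡ s i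
      first : Z 1 < 2 * a 1

  module _ (sc : SumConditions) where
    open SumConditions sc

    pairBound-at : ∀ Z i → 2 ≤ i → Z i ≡ s i → Z (i ∸ 1) ≡ s (i ∸ 1) → PairBoundAt Z i
    pairBound-at Z i 2≤i e e′ rewrite e | e′ =
      pairBound-sum {A = a i} {A′ = a (i ∸ 1)} (bounded₂ i) (double⇒pred-zero i 2≤i)

    pairBound-at+1 : ∀ Z i → 2 ≤ i → Z i ≡ s i + 1 → Z (i ∸ 1) ≡ s (i ∸ 1) → PairBoundAt Z i
    pairBound-at+1 Z i 2≤i e e′ rewrite e | e′ =
      pairBound-sum+1 {A = a i} {A′ = a (i ∸ 1)}
        (bounded₂ i) (double⇒pred-zero i 2≤i) (near-double⇒pred-bounded i 2≤i)

    start : ∀ k → m ≤ 3 + k → s (3 + k) ≡ 0 → Invariant (3 + k) s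
    start k m≤K s-top = record
      { normalised = λ i K<i i≤m → ⊥-elim (<⇒≱ K<i (≤-trans i≤m m≤K))
      ; at-K = subst (_≤ _) (sym s-top) z≤n
      ; at-K-max = λ e → ⊥-elim (<⇒≢ (a-pos (3 + k) (s≤s z≤n)) (trans (sym s-top) e))
      ; at-K-1 = pairBound-at s (2 + k) (s≤s (s≤s z≤n)) refl refl
      ; at-K-2 = λ 2≤k+1 → pairBound-at s (1 + k) 2≤k+1 refl refl
      ; untouched = λ _ _ → refl
      ; first = ≤-pred (m≤n⇒m≤1+n first-slack) }

    stepA1-invariant : ∀ j Z → Invariant (4 + j) Z → CondA1 j Z →
      Invariant (3 + j) (upd₄ Z (1 + j) (Z (4 + j) + 1) (Z (3 + j) ∸ (a (3 + j) + 1)) (a (2 + j) ∸ 1) (Z (1 + j) + 1))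
    stepA1-invariant j Z inv (c₁ , _ , _) = record
      { normalised = normalised′ ; at-K = at-K′ ; at-K-max = at-K-max′ ; at-K-1 = at-K-1′
      ; at-K-2 = at-K-2′ ; untouched = untouched′ ; first = first′ j refl }
      where
      open Invariant inv
      v₃ v₂ v₁ v₀ : ℕ
      v₃ = Z (4 + j) + 1
      v₂ = Z (3 + j) ∸ (a (3 + j) + 1)
      v₁ = a (2 + j) ∸ 1
      v₀ = Z (1 + j) + 1
      Z′ : Word
      Z′ = upd₄ Z (1 + j) v₃ v₂ v₁ v₀
      normalised′ : ∀ i → 3 + j < i → i ≤ m → Z′ i ≤ a i
      normalised′ i K<i i≤m with m≤n⇒m<n∨m≡n K<i
      ... | inj₂ refl = subst (_≤ a (4 + j)) (sym (upd₄-at₃ Z (1 + j) v₃ v₂ v₁ v₀)) (<⇒+1≤ c₁)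
      ... | inj₁ K+1<i =
        subst (_≤ a i) (sym (upd₄-above Z (1 + j) v₃ v₂ v₁ v₀ i K+1<i)) (normalised i K+1<i i≤m)
      at-K′ : Z′ (3 + j) ≤ a (3 + j)
      at-K′ = subst (_≤ a (3 + j)) (sym (upd₄-at₂ Z (1 + j) v₃ v₂ v₁ v₀)) (∸-half-suc-≤ (proj₁ at-K-1))
      at-K-max′ : Z′ (3 + j) ≡ a (3 + j) → Z′ (2 + j) < a (2 + j)
      at-K-max′ _ =
        subst (_< a (2 + j)) (sym (upd₄-at₁ Z (1 + j) v₃ v₂ v₁ v₀)) (∸1-< (a-pos (2 + j) (s≤s z≤n)) ≤-refl)
      at-K-1′ : PairBoundAt Z′ (2 + j)
      at-K-1′ = subst (λ y → PairBound y (Z′ (1 + j)) (a (2 + j)) (a (1 + j)))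
                  (sym (upd₄-at₁ Z (1 + j) v₃ v₂ v₁ v₀))
                  (pairBound-small (m∸n≤m _ 1) (a-pos (2 + j) (s≤s z≤n)))
      at-K-2′ : 2 ≤ 1 + j → PairBoundAt Z′ (1 + j)
      at-K-2′ 2≤1+j = pairBound-at+1 Z′ (1 + j) 2≤1+j
        (trans (upd₄-at₀ Z (1 + j) v₃ v₂ v₁ v₀) (cong (_+ 1) (untouched (1 + j) ≤-refl)))
        (trans (upd₄-below Z (1 + j) v₃ v₂ v₁ v₀ j (n<1+n j)) (untouched j (n≤1+n j)))
      untouched′ : ∀ i → i ≤ j → Z′ i ≡ s i
      untouched′ i i≤j =
        trans (upd₄-below Z (1 + j) v₃ v₂ v₁ v₀ i (s≤s i≤j)) (untouched i (m≤n⇒m≤1+n i≤j))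
      -- Position 1 only changes when j = 0, and then gains one.
      first′ : ∀ k → k ≡ j → Z′ 1 < 2 * a 1
      first′ zero refl rewrite upd₄-at₀ Z 1 v₃ v₂ v₁ v₀ | untouched 1 ≤-refl | +-comm (s 1) 1 = first-slack
      first′ (suc k) refl rewrite upd₄-below Z (2 + k) v₃ v₂ v₁ v₀ 1 (s≤s (s≤s z≤n)) = first

    stepA2-invariant : ∀ j Z → Invariant (4 + j) Z → CondA2 j Z →
      Invariant (3 + j) (upd₃ Z (2 + j) (Z (4 + j) + 1) (Z (3 + j) ∸ a (3 + j)) (Z (2 + j) ∸ 1))
    stepA2-invariant j Z inv (c₁ , c₂ , c₃ , c₄) = record
      { normalised = normalised′ ; at-K = at-K′ ; at-K-max = at-K-max′ ; at-K-1 = at-K-1′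
      ; at-K-2 = at-K-2′ ; untouched = untouched′ ; first = first′ }
      where
      open Invariant inv
      v₂ v₁ v₀ : ℕ
      v₂ = Z (4 + j) + 1
      v₁ = Z (3 + j) ∸ a (3 + j)
      v₀ = Z (2 + j) ∸ 1
      Z′ : Word
      Z′ = upd₃ Z (2 + j) v₂ v₁ v₀
      normalised′ : ∀ i → 3 + j < i → i ≤ m → Z′ i ≤ a i
      normalised′ i K<i i≤m with m≤n⇒m<n∨m≡n K<i
      ... | inj₂ refl = subst (_≤ a (4 + j)) (sym (upd₃-at₂ Z (2 + j) v₂ v₁ v₀)) (<⇒+1≤ c₁)
      ... | inj₁ K+1<i = subst (_≤ a i) (sym (upd₃-above Z (2 + j) v₂ v₁ v₀ i K+1<i)) (normalised i K+1<i i≤m)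
      at-K′ : Z′ (3 + j) ≤ a (3 + j)
      at-K′ = subst (_≤ a (3 + j)) (sym (upd₃-at₁ Z (2 + j) v₂ v₁ v₀)) (∸-half-≤ c₃)
      at-K-max′ : Z′ (3 + j) ≡ a (3 + j) → Z′ (2 + j) < a (2 + j)
      at-K-max′ e = subst (_< a (2 + j)) (sym (upd₃-at₀ Z (2 + j) v₂ v₁ v₀))
        (∸1-< c₄ (proj₂ (proj₂ at-K-1) (∸-half-≡ c₂ (trans (sym (upd₃-at₁ Z (2 + j) v₂ v₁ v₀)) e))))
      at-K-1′ : PairBoundAt Z′ (2 + j)
      at-K-1′ = subst₂ (λ y u → PairBound y u (a (2 + j)) (a (1 + j)))
        (sym (upd₃-at₀ Z (2 + j) v₂ v₁ v₀)) (sym (upd₃-below Z (2 + j) v₂ v₁ v₀ (1 + j) (n<1+n _)))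
        (pairBound-pred {A = a (2 + j)} {A′ = a (1 + j)} (at-K-2 (s≤s (s≤s z≤n))) c₄)
      at-K-2′ : 2 ≤ 1 + j → PairBoundAt Z′ (1 + j)
      at-K-2′ 2≤1+j = pairBound-at Z′ (1 + j) 2≤1+j
        (trans (upd₃-below Z (2 + j) v₂ v₁ v₀ (1 + j) (n<1+n _)) (untouched (1 + j) ≤-refl))
        (trans (upd₃-below Z (2 + j) v₂ v₁ v₀ j (<-trans (n<1+n j) (n<1+n _))) (untouched j (n≤1+n j)))
      untouched′ : ∀ i → i ≤ j → Z′ i ≡ s i
      untouched′ i i≤j =
        trans (upd₃-below Z (2 + j) v₂ v₁ v₀ i (s≤s (m≤n⇒m≤1+n i≤j))) (untouched i (m≤n⇒m≤1+n i≤j))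
      first′ : Z′ 1 < 2 * a 1
      first′ = subst (_< 2 * a 1) (sym (upd₃-below Z (2 + j) v₂ v₁ v₀ 1 (s≤s (s≤s z≤n)))) first

    stepA3-invariant : ∀ j Z → Invariant (4 + j) Z → ¬ CondA1 j Z → ¬ CondA2 j Z → Invariant (3 + j) Z
    stepA3-invariant j Z inv ¬c₁ ¬c₂ = record
      { normalised = normalised′ ; at-K = at-K′ ; at-K-max = at-K-max′ ; at-K-1 = at-K-2 (s≤s (s≤s z≤n))
      ; at-K-2 = λ 2≤1+j → pairBound-at Z (1 + j) 2≤1+j (untouched (1 + j) ≤-refl) (untouched j (n≤1+n j))
      ; untouched = λ i i≤j → untouched i (m≤n⇒m≤1+n i≤j) ; first = first }
      where
      open Invariant inv
      normalised′ : ∀ i → 3 + j < i → i ≤ m → Z i ≤ a i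
      normalised′ i K<i i≤m with m≤n⇒m<n∨m≡n K<i
      ... | inj₂ refl = at-K
      ... | inj₁ K+1<i = normalised i K+1<i i≤m
      at-K′ : Z (3 + j) ≤ a (3 + j)
      at-K′ with m≤n⇒m<n∨m≡n at-K | Z (3 + j) ≤? a (3 + j)
      ... | inj₂ top≡a | _ = <⇒≤ (at-K-max top≡a)
      ... | inj₁ _ | yes ≤a = ≤a
      ... | inj₁ top<a | no ≰a with Z (2 + j) ≟ 0 | Z (3 + j) ≤? 2 * a (3 + j)
      ... | yes z≡0 | _ = ⊥-elim (¬c₁ (top<a , ≰⇒> ≰a , z≡0))
      ... | no z≢0 | yes ≤2a = ⊥-elim (¬c₂ (top<a , <⇒≤ (≰⇒> ≰a) , ≤2a , n≢0⇒n>0 z≢0))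
      ... | no z≢0 | no ≰2a = ⊥-elim (z≢0 (proj₁ (proj₂ at-K-1) (≤-antisym (proj₁ at-K-1) (≰⇒> ≰2a))))
      at-K-max′ : Z (3 + j) ≡ a (3 + j) → Z (2 + j) < a (2 + j)
      at-K-max′ e with m≤n⇒m<n∨m≡n at-K | Z (2 + j) ≟ 0
      ... | inj₂ top≡a | _ = ⊥-elim (<⇒≢ (at-K-max top≡a) e)
      ... | inj₁ _ | yes z≡0 = subst (_< a (2 + j)) (sym z≡0) (a-pos (2 + j) (s≤s z≤n))
      ... | inj₁ top<a | no z≢0 =
        ⊥-elim (¬c₂ (top<a , ≤-reflexive (sym e) , subst (_≤ 2 * a (3 + j)) (sym e) (m≤m+n _ _) , n≢0⇒n>0 z≢0))

    stepA-invariant : ∀ j Z → Invariant (4 + j) Z → Invariant (3 + j) (stepA a (4 + j) Z)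
    stepA-invariant j Z inv with stepA-view j Z
    ... | fireA1 c e = subst (Invariant (3 + j)) (sym e) (stepA1-invariant j Z inv c)
    ... | fireA2 c e = subst (Invariant (3 + j)) (sym e) (stepA2-invariant j Z inv c)
    ... | idleA ¬c₁ ¬c₂ e = subst (Invariant (3 + j)) (sym e) (stepA3-invariant j Z inv ¬c₁ ¬c₂)

    bounded-from-parts : ∀ Z → Z 1 < a 1 → Z 2 ≤ a 2 → Z 3 ≤ a 3 →
      (∀ i → 3 < i → i ≤ m → Z i ≤ a i) → BoundedUpTo m Z
    bounded-from-parts Z Z₁<a₁ Z₂≤a₂ Z₃≤a₃ Z≤a = bound , Z₁<a₁
      where
      bound : ∀ i → 1 ≤ i → i ≤ m → Z i ≤ a i
      bound 1 _ _ = <⇒≤ Z₁<a₁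
      bound 2 _ _ = Z₂≤a₂
      bound 3 _ _ = Z₃≤a₃
      bound (suc (suc (suc (suc i)))) _ i≤m = Z≤a _ (s≤s (s≤s (s≤s (s≤s z≤n)))) i≤m

    stepB-bounded : ∀ Z → Invariant 3 Z → BoundedUpTo m (stepB a Z)
    stepB-bounded Z inv with stepB-view Z
    ... | fireB1 (c₁ , _ , _) e = subst (BoundedUpTo m) (sym e) (bounded-from-parts _
          (subst (_< a 1) (sym (upd₃-at₀ Z 1 v₂ v₁ v₀)) (∸1-< (a-pos 1 (s≤s z≤n)) ≤-refl))
          (subst (_≤ a 2) (sym (upd₃-at₁ Z 1 v₂ v₁ v₀)) (∸-half-suc-≤ (proj₁ at-K-1)))
          (subst (_≤ a 3) (sym (upd₃-at₂ Z 1 v₂ v₁ v₀)) (<⇒+1≤ c₁))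
          (λ i 3<i i≤m → subst (_≤ a i) (sym (upd₃-above Z 1 v₂ v₁ v₀ i 3<i)) (normalised i 3<i i≤m)))
      where
      open Invariant inv
      v₂ v₁ v₀ : ℕ
      v₂ = Z 3 + 1
      v₁ = Z 2 ∸ (a 2 + 1)
      v₀ = a 1 ∸ 1
    ... | fireB2 (c₁ , _ , c₃ , c₄) e = subst (BoundedUpTo m) (sym e) (bounded-from-parts _
          (subst (_< a 1) (sym (upd₃-at₀ Z 1 v₂ v₁ v₀)) (∸1-< c₃ c₄))
          (subst (_≤ a 2) (sym (upd₃-at₁ Z 1 v₂ v₁ v₀)) (∸-half-≤ Z₂≤2a₂))
          (subst (_≤ a 3) (sym (upd₃-at₂ Z 1 v₂ v₁ v₀)) (<⇒+1≤ c₁))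
          (λ i 3<i i≤m → subst (_≤ a i) (sym (upd₃-above Z 1 v₂ v₁ v₀ i 3<i)) (normalised i 3<i i≤m)))
      where
      open Invariant inv
      v₂ v₁ v₀ : ℕ
      v₂ = Z 3 + 1
      v₁ = Z 2 ∸ a 2
      v₀ = Z 1 ∸ 1
      Z₂≤2a₂ : Z 2 ≤ 2 * a 2
      Z₂≤2a₂ = ≤-suc-≢ (proj₁ at-K-1) (λ e′ → <⇒≢ c₃ (sym (proj₁ (proj₂ at-K-1) e′)))
    ... | fireB3 (c₁ , c₂ , c₃) e = subst (BoundedUpTo m) (sym e) (bounded-from-parts _
          (subst (_< a 1) (sym (upd₃-at₀ Z 1 v₂ v₁ v₀)) (∸-half-suc-< c₃ first))
          (subst (_≤ a 2) (sym (upd₃-at₁ Z 1 v₂ v₁ v₀)) (<⇒+1≤ (∸-half-< c₂ Z₂<2a₂)))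
          (subst (_≤ a 3) (sym (upd₃-at₂ Z 1 v₂ v₁ v₀)) (<⇒+1≤ c₁))
          (λ i 3<i i≤m → subst (_≤ a i) (sym (upd₃-above Z 1 v₂ v₁ v₀ i 3<i)) (normalised i 3<i i≤m)))
      where
      open Invariant inv
      v₂ v₁ v₀ : ℕ
      v₂ = Z 3 + 1
      v₁ = (Z 2 ∸ a 2) + 1
      v₀ = Z 1 ∸ (a 1 + 1)
      -- Z₁ > a₁ ≥ 1, so position 2 is neither 2a₂ + 1 nor 2a₂.
      Z₂≤2a₂ : Z 2 ≤ 2 * a 2
      Z₂≤2a₂ =
        ≤-suc-≢ (proj₁ at-K-1) (λ e′ → <⇒≢ (≤-trans (s≤s z≤n) c₃) (sym (proj₁ (proj₂ at-K-1) e′)))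
      Z₂<2a₂ : Z 2 < 2 * a 2
      Z₂<2a₂ = ≤∧≢⇒< Z₂≤2a₂ (λ e′ → <⇒≱ c₃ (proj₂ (proj₂ at-K-1) e′))
    ... | fireB4 (c₁ , c₂) e = subst (BoundedUpTo m) (sym e) (bounded-from-parts _
          (subst (_< a 1) (sym (upd₂-at₀ Z 1 v₁ v₀)) (∸-half-< c₂ first))
          (subst (_≤ a 2) (sym (upd₂-at₁ Z 1 v₁ v₀)) (<⇒+1≤ c₁))
          (subst (_≤ a 3) (sym (upd₂-out Z 1 v₁ v₀ 3 (λ ()) (λ ()))) at-K)
          (λ i 3<i i≤m → subst (_≤ a i)
             (sym (upd₂-out Z 1 v₁ v₀ i (above≢ 2 3<i 0 z≤n) (above≢ 2 3<i 1 (s≤s z≤n))))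
             (normalised i 3<i i≤m)))
      where
      open Invariant inv
      v₁ v₀ : ℕ
      v₁ = Z 2 + 1
      v₀ = Z 1 ∸ a 1
    ... | idleB ¬c₁ ¬c₂ ¬c₃ ¬c₄ e =
      subst (BoundedUpTo m) (sym e) (bounded-from-parts Z Z₁<a₁ Z₂≤a₂ at-K normalised)
      where
      open Invariant inv
      Z₁<a₁ : Z 1 < a 1
      Z₁<a₁ with Z 1 <? a 1
      ... | yes <a = <a
      ... | no ≮a with Z 2 <? a 2
      ... | yes Z₂<a₂ = ⊥-elim (¬c₄ (Z₂<a₂ , ≮⇒≥ ≮a))
      ... | no Z₂≮a₂ with m≤n⇒m<n∨m≡n at-K
      ... | inj₂ Z₃≡a₃ = ⊥-elim (Z₂≮a₂ (at-K-max Z₃≡a₃))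
      ... | inj₁ Z₃<a₃ with a 1 <? Z 1
      ... | yes a₁<Z₁ = ⊥-elim (¬c₃ (Z₃<a₃ , ≮⇒≥ Z₂≮a₂ , a₁<Z₁))
      ... | no a₁≮Z₁ =
        ⊥-elim (¬c₂ (Z₃<a₃ , ≮⇒≥ Z₂≮a₂ , ≤-trans (a-pos 1 (s≤s z≤n)) (≮⇒≥ ≮a) , ≮⇒≥ a₁≮Z₁))
      Z₂≤a₂ : Z 2 ≤ a 2
      Z₂≤a₂ with Z 2 ≤? a 2
      ... | yes ≤a = ≤a
      ... | no ≰a with m≤n⇒m<n∨m≡n at-K
      ... | inj₂ Z₃≡a₃ = ⊥-elim (≰a (<⇒≤ (at-K-max Z₃≡a₃)))
      ... | inj₁ Z₃<a₃ with Z 1 ≟ 0 | Z 1 ≤? a 1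
      ... | yes Z₁≡0 | _ = ⊥-elim (¬c₁ (Z₃<a₃ , ≰⇒> ≰a , Z₁≡0))
      ... | no Z₁≢0 | yes Z₁≤a₁ = ⊥-elim (¬c₂ (Z₃<a₃ , <⇒≤ (≰⇒> ≰a) , n≢0⇒n>0 Z₁≢0 , Z₁≤a₁))
      ... | no _ | no Z₁≰a₁ = ⊥-elim (¬c₃ (Z₃<a₃ , <⇒≤ (≰⇒> ≰a) , ≰⇒> Z₁≰a₁))

    alg1-bounded : ∀ j Z → Invariant (3 + j) Z → BoundedUpTo m (alg1From a (3 + j) Z)
    alg1-bounded zero    Z inv = stepB-bounded Z inv
    alg1-bounded (suc j) Z inv = alg1-bounded j _ (stepA-invariant j Z inv)

module StepCFacts (a : ℕ → ℕ) (a-pos : ∀ i → 1 ≤ i → 1 ≤ a i) where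
  open Steps a
  open Bounds a

  0≢a : ∀ i → 1 ≤ i → 0 ≢ a i
  0≢a i 1≤i 0≡a = <⇒≢ (subst (1 ≤_) (sym 0≡a) (a-pos i 1≤i)) refl

  firedC-bounded : ∀ j w → Bounded w → w (3 + j) < a (3 + j) → Bounded (firedC j w)
  firedC-bounded j w (w≤a , w₁<a₁) c₁ = bound , first j refl
    where
    v₂ v₀ : ℕ
    v₂ = w (3 + j) + 1
    v₀ = w (1 + j) ∸ 1
    bound : ∀ i → 1 ≤ i → firedC j w i ≤ a i
    bound i 1≤i with upd₃-cases w (1 + j) v₂ 0 v₀ i
    ... | inj₁ refl = subst (_≤ a (3 + j)) (sym (upd₃-at₂ w (1 + j) v₂ 0 v₀)) (<⇒+1≤ c₁)
    ... | inj₂ (inj₁ refl) = subst (_≤ a (2 + j)) (sym (upd₃-at₁ w (1 + j) v₂ 0 v₀)) z≤n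
    ... | inj₂ (inj₂ (inj₁ refl)) =
      subst (_≤ a (1 + j)) (sym (upd₃-at₀ w (1 + j) v₂ 0 v₀)) (≤-trans (m∸n≤m _ 1) (w≤a (1 + j) 1≤i))
    ... | inj₂ (inj₂ (inj₂ e)) = subst (_≤ a i) (sym e) (w≤a i 1≤i)
    -- Position 1 only changes when j = 0, and then decreases.
    first : ∀ k → k ≡ j → firedC j w 1 < a 1
    first zero refl = subst (_< a 1) (sym (upd₃-at₀ w 1 v₂ 0 v₀)) (≤-<-trans (m∸n≤m _ 1) w₁<a₁)
    first (suc k) refl = subst (_< a 1) (sym (upd₃-below w (2 + k) v₂ 0 v₀ 1 (s≤s (s≤s z≤n)))) w₁<a₁

  firedC-middle≢a : ∀ j w → firedC j w (2 + j) ≢ a (2 + j)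
  firedC-middle≢a j w e =
    0≢a (2 + j) (s≤s z≤n) (trans (sym (upd₃-at₁ w (1 + j) (w (3 + j) + 1) 0 (w (1 + j) ∸ 1))) e)

  firedC-bottom≢a : ∀ j w → Bounded w → 1 ≤ w (1 + j) → firedC j w (1 + j) ≢ a (1 + j)
  firedC-bottom≢a j w (w≤a , _) 1≤w e =
    <⇒≢ (∸1-< 1≤w (w≤a (1 + j) (s≤s z≤n)))
        (trans (sym (upd₃-at₀ w (1 + j) (w (3 + j) + 1) 0 (w (1 + j) ∸ 1))) e)

  -- A valley a_{k+1} 0 a_{k-1} c (c > 0) at positions k+1 … k-2.  The step
  -- at k would turn it into a_{k+1} 1 0 (c-1), which violates the Ostrowski
  -- condition at k + 1, above the steps still to come in Algorithm 3.
  Valley : Word → ℕ → Set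
  Valley w k = w (suc k) ≡ a (suc k) × w k ≡ 0 × w (k ∸ 1) ≡ a (k ∸ 1) × 1 ≤ w (k ∸ 2)

  valley-in-trunc : ∀ r w k → 3 ≤ k → Valley (trunc (suc r) w) k → k ≤ r × Valley w k
  valley-in-trunc r w k 3≤k (e₁ , e₀ , e₋₁ , p) with k ≤? r
  ... | no k≰r =
    ⊥-elim (0≢a (suc k) (s≤s z≤n) (trans (sym (trunc-out (suc r) w (suc k) (s≤s (≰⇒> k≰r)))) e₁))
  ... | yes k≤r =
    k≤r ,
    trans (sym (inside (suc k) (s≤s z≤n) (s≤s k≤r))) e₁ ,
    trans (sym (inside k (≤-trans (s≤s z≤n) 3≤k) (m≤n⇒m≤1+n k≤r))) e₀ ,
    trans (sym (inside (k ∸ 1) (∸-monoˡ-≤ 1 (<⇒≤ 3≤k)) (≤-trans (m∸n≤m k 1) (m≤n⇒m≤1+n k≤r)))) e₋₁ ,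
    subst (1 ≤_) (inside (k ∸ 2) (∸-monoˡ-≤ 2 3≤k) (≤-trans (m∸n≤m k 2) (m≤n⇒m≤1+n k≤r))) p
    where
    inside : ∀ i → 1 ≤ i → i ≤ suc r → trunc (suc r) w i ≡ w i
    inside = trunc-in (suc r) w

  valley-below-firedC : ∀ j w k → suc k < 1 + j → Valley (firedC j w) k → Valley w k
  valley-below-firedC j w k k+1<j+1 (e₁ , e₀ , e₋₁ , p) =
    trans (sym (old (suc k) k+1<j+1)) e₁ ,
    trans (sym (old k (<-trans (n<1+n k) k+1<j+1))) e₀ ,
    trans (sym (old (k ∸ 1) (≤-<-trans (m∸n≤m k 1) (<-trans (n<1+n k) k+1<j+1)))) e₋₁ ,
    subst (1 ≤_) (old (k ∸ 2) (≤-<-trans (m∸n≤m k 2) (<-trans (n<1+n k) k+1<j+1))) p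
    where
    old : ∀ i → i < 1 + j → firedC j w i ≡ w i
    old = upd₃-below w (1 + j) (w (3 + j) + 1) 0 (w (1 + j) ∸ 1)

  -- Valleys near a firing window cannot exist, since they need the middle
  -- or the bottom digit of the window at its bound.
  no-valley-at-firedC : ∀ j w k → Bounded w → CondC j w → j ≤ k → k ≤ 3 + j → ¬ Valley (firedC j w) k
  no-valley-at-firedC j w k bnd (_ , _ , c₃) j≤k k≤3+j (e₁ , _ , e₋₁ , _) with window-cases j k j≤k k≤3+j
  ... | inj₁ refl = firedC-bottom≢a j w bnd c₃ e₁
  ... | inj₂ (inj₁ refl) = firedC-middle≢a j w e₁
  ... | inj₂ (inj₂ (inj₁ refl)) = firedC-bottom≢a j w bnd c₃ e₋₁
  ... | inj₂ (inj₂ (inj₂ refl)) = firedC-middle≢a j w e₋₁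

module Pass2 (a : ℕ → ℕ) (a-pos : ∀ i → 1 ≤ i → 1 ≤ a i) where
  open Steps a
  open Bounds a
  open StepCFacts a a-pos

  record Invariant (K : ℕ) (w : Word) : Set where
    field
      bounded : Bounded w
      no-valley : ∀ k → 3 ≤ k → k ≤ K → ¬ Valley w k
      settled : 3 ≤ K → w K ≡ 0 → w (K ∸ 1) ≡ a (K ∸ 1) → ¬ (1 ≤ w (K ∸ 2))

  stepC-invariant : ∀ j w → Invariant (2 + j) w → Invariant (3 + j) (stepC a (3 + j) w)
  stepC-invariant j w inv with stepC-view j w
  ... | idleC ¬c e rewrite e = record { bounded = bounded ; no-valley = no-valley′ ; settled = settled′ }
    where
    open Invariant inv
    settled′ : 3 ≤ 3 + j → w (3 + j) ≡ 0 → w (2 + j) ≡ a (2 + j) → ¬ (1 ≤ w (1 + j))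
    settled′ _ top≡0 mid≡a 1≤bot =
      ¬c (subst (_< a (3 + j)) (sym top≡0) (a-pos (3 + j) (s≤s z≤n)) , mid≡a , 1≤bot)
    no-valley′ : ∀ k → 3 ≤ k → k ≤ 3 + j → ¬ Valley w k
    no-valley′ k 3≤k k≤3+j valley with m≤n⇒m<n∨m≡n k≤3+j
    ... | inj₁ k<3+j = no-valley k 3≤k (≤-pred k<3+j) valley
    ... | inj₂ refl = let (_ , e₀ , e₋₁ , p) = valley in settled′ 3≤k e₀ e₋₁ p
  ... | fireC c e rewrite e = record
    { bounded = firedC-bounded j w bounded (proj₁ c) ; no-valley = no-valley′
    ; settled = λ _ _ mid≡a _ → firedC-middle≢a j w mid≡a }
    where
    open Invariant inv
    no-valley′ : ∀ k → 3 ≤ k → k ≤ 3 + j → ¬ Valley (firedC j w) k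
    no-valley′ k 3≤k k≤3+j valley with suc k ≤? j
    ... | yes k<j = no-valley k 3≤k (≤-trans (≤-trans (n≤1+n k) k<j) (m≤n+m j 2))
                      (valley-below-firedC j w k (s≤s k<j) valley)
    ... | no k≮j = no-valley-at-firedC j w k bounded c (≮⇒≥ k≮j) k≤3+j valley

  start : ∀ w → Bounded w → Invariant 2 w
  start w bnd = record
    { bounded = bnd
    ; no-valley = λ k 3≤k k≤2 _ → <⇒≱ 3≤k k≤2
    ; settled = λ 3≤2 → ⊥-elim (<⇒≱ 3≤2 ≤-refl) }

  runUp-invariant : ∀ j w → Invariant 2 w → Invariant (2 + j) (runUp a (2 + j) w)
  runUp-invariant zero    w inv = inv
  runUp-invariant (suc j) w inv = stepC-invariant j _ (runUp-invariant j w inv)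

module Pass3 (a : ℕ → ℕ) (a-pos : ∀ i → 1 ≤ i → 1 ≤ a i) where
  open Steps a
  open Bounds a
  open StepCFacts a a-pos

  Violation : Word → ℕ → Set
  Violation v i = v i ≡ a i × 1 ≤ v (i ∸ 1)

  -- Algorithm 3 on a word of length R, before the step at K + 1: the bounds
  -- hold, there is no violation from K up to R and no valley up to K.
  record Invariant (R K : ℕ) (v : Word) : Set where
    field
      bounded : Bounded v
      no-violation : ∀ i → K ≤ i → i ≤ R → ¬ Violation v i
      no-valley : ∀ k → 3 ≤ k → k ≤ K → ¬ Valley v k

  stepC-invariant : ∀ R j v → 3 + j ≤ R → Invariant R (3 + j) v → Invariant R (2 + j) (stepC a (3 + j) v)
  stepC-invariant R j v 3+j≤R inv with stepC-view j v
  ... | idleC ¬c e rewrite e = record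
    { bounded = bounded ; no-violation = no-violation′
    ; no-valley = λ k 3≤k k≤2+j → no-valley k 3≤k (m≤n⇒m≤1+n k≤2+j) }
    where
    open Invariant inv
    -- A violation at 2 + j is repaired by the step, unless position 3 + j is
    -- at its bound, and then there is a violation at 3 + j.
    no-violation′ : ∀ i → 2 + j ≤ i → i ≤ R → ¬ Violation v i
    no-violation′ i 2+j≤i i≤R viol with m≤n⇒m<n∨m≡n 2+j≤i
    ... | inj₁ 2+j<i = no-violation i 2+j<i i≤R viol
    ... | inj₂ refl with v (3 + j) <? a (3 + j)
    ... | yes top<a = ¬c (top<a , viol)
    ... | no top≮a = no-violation (3 + j) ≤-refl 3+j≤R
      (≤-antisym (proj₁ bounded (3 + j) (s≤s z≤n)) (≮⇒≥ top≮a) ,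
       subst (1 ≤_) (sym (proj₁ viol)) (a-pos (2 + j) (s≤s z≤n)))
  ... | fireC c e rewrite e = record
    { bounded = firedC-bounded j v bounded (proj₁ c) ; no-violation = no-violation′ ; no-valley = no-valley′ }
    where
    open Invariant inv
    v′ : Word
    v′ = firedC j v
    above : ∀ i → 3 + j < i → v′ i ≡ v i
    above = upd₃-above v (1 + j) (v (3 + j) + 1) 0 (v (1 + j) ∸ 1)
    -- The only violation the step could create is at 4 + j, where it would
    -- come from a violation or a valley at 3 + j before the step.
    no-violation′ : ∀ i → 2 + j ≤ i → i ≤ R → ¬ Violation v′ i
    no-violation′ i 2+j≤i i≤R (e , p) with ≥-cases (2 + j) i 2+j≤i
    ... | inj₁ refl = firedC-middle≢a j v e
    ... | inj₂ (inj₁ refl) = <⇒≢ p (sym (upd₃-at₁ v (1 + j) (v (3 + j) + 1) 0 (v (1 + j) ∸ 1)))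
    ... | inj₂ (inj₂ (inj₁ refl)) with v (3 + j) ≟ 0
    ...   | yes v₃≡0 = no-valley (3 + j) (s≤s (s≤s (s≤s z≤n))) ≤-refl
                         (trans (sym (above (4 + j) ≤-refl)) e , v₃≡0 , proj₁ (proj₂ c) , proj₂ (proj₂ c))
    ...   | no v₃≢0 = no-violation (4 + j) (n≤1+n _) i≤R (trans (sym (above (4 + j) ≤-refl)) e , n≢0⇒n>0 v₃≢0)
    no-violation′ i 2+j≤i i≤R (e , p) | inj₂ (inj₂ (inj₂ 5+j≤i)) =
      no-violation i (≤-trans (n≤1+n _) (≤-trans (n≤1+n _) 5+j≤i)) i≤R
        (trans (sym (above i (≤-trans (n≤1+n _) 5+j≤i))) e ,
         subst (1 ≤_) (above (i ∸ 1) (∸-monoˡ-≤ 1 5+j≤i)) p)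
    no-valley′ : ∀ k → 3 ≤ k → k ≤ 2 + j → ¬ Valley v′ k
    no-valley′ k 3≤k k≤2+j valley with suc k ≤? j
    ... | yes k<j = no-valley k 3≤k (m≤n⇒m≤1+n k≤2+j) (valley-below-firedC j v k (s≤s k<j) valley)
    ... | no k≮j = no-valley-at-firedC j v k bounded c (≮⇒≥ k≮j) (m≤n⇒m≤1+n k≤2+j) valley

  start : ∀ r w → Bounded w → (∀ k → 3 ≤ k → k ≤ r → ¬ Valley w k) →
    Invariant (2 + r) (2 + r) (trunc (suc r) w)
  start r w bnd no-valley = record
    { bounded = trunc-bounded (suc r) w (s≤s z≤n) (bounded-upTo (suc r) w bnd)
    ; no-violation = λ i R≤i i≤R (e , _) →
        0≢a i (≤-trans (s≤s z≤n) R≤i) (trans (sym (trunc-out (suc r) w i R≤i)) e)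
    ; no-valley = λ k 3≤k _ valley → let (k≤r , valley′) = valley-in-trunc r w k 3≤k valley in
        no-valley k 3≤k k≤r valley′ }

  runDown-invariant : ∀ R j v → 2 + j ≤ R → Invariant R (2 + j) v → Invariant R 2 (runDown a (2 + j) v)
  runDown-invariant R zero    v _      inv = inv
  runDown-invariant R (suc j) v 3+j≤R inv =
    runDown-invariant R j _ (≤-trans (n≤1+n _) 3+j≤R) (stepC-invariant R j v 3+j≤R inv)

  invariant⇒ostrowski : ∀ R v → Invariant R 2 v → IsOstrowski a R v
  invariant⇒ostrowski R v inv =
    (λ _ → proj₂ bounded) ,
    (λ i 1≤i _ → proj₁ bounded i 1≤i) ,
    (λ i 2≤i i≤R e → n≤0⇒n≡0 (≮⇒≥ (λ 1≤pred → no-violation i 2≤i i≤R (e , 1≤pred))))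
    where open Invariant inv

sum-conditions : ∀ a (a-pos : ∀ i → 1 ≤ i → 1 ≤ a i) n x y → 1 ≤ n →
  IsOstrowski a n x → IsOstrowski a n y → Pass1.SumConditions a a-pos (sumWord n x y) (suc n)
sum-conditions a a-pos n x y 1≤n (x₁<a₁ , x≤a , x-max) (y₁<a₁ , y≤a , y-max) = record
  { bounded₂ = bounded₂ ; double⇒pred-zero = double⇒pred-zero
  ; near-double⇒pred-bounded = near-double⇒pred-bounded
  ; first-slack = first-slack ; top-zero = trunc-out n (λ i → x i + y i) (suc n) ≤-refl }
  where
  s : Word
  s = sumWord n x y
  sum-cases : ∀ i → (1 ≤ i × i ≤ n) ⊎ s i ≡ 0
  sum-cases zero = inj₂ refl
  sum-cases (suc i) with suc i ≤? n
  ... | yes i<n = inj₁ (s≤s z≤n , i<n)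
  ... | no i≮n = inj₂ (trunc-out n (λ j → x j + y j) (suc i) (≰⇒> i≮n))
  sum-at : ∀ i → 1 ≤ i → i ≤ n → s i ≡ x i + y i
  sum-at = trunc-in n (λ i → x i + y i)
  pred-range : ∀ i → 2 ≤ i → i ≤ n → 1 ≤ i ∸ 1 × i ∸ 1 ≤ n
  pred-range i 2≤i i≤n = ∸-monoˡ-≤ 1 2≤i , ≤-trans (m∸n≤m i 1) i≤n
  a-pos′ : ∀ i → 2 ≤ i → 1 ≤ a i
  a-pos′ i 2≤i = a-pos i (≤-trans (s≤s z≤n) 2≤i)
  bounded₂ : ∀ i → s i ≤ 2 * a i
  bounded₂ i with sum-cases i
  ... | inj₂ s≡0 = subst (_≤ 2 * a i) (sym s≡0) z≤n
  ... | inj₁ (1≤i , i≤n) rewrite sum-at i 1≤i i≤n | 2*-double (a i) =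
    +-mono-≤ (x≤a i 1≤i i≤n) (y≤a i 1≤i i≤n)
  double⇒pred-zero : ∀ i → 2 ≤ i → s i ≡ 2 * a i → s (i ∸ 1) ≡ 0
  double⇒pred-zero i 2≤i e with sum-cases i
  ... | inj₂ s≡0 = ⊥-elim (<⇒≢ (≤-trans (a-pos′ i 2≤i) (m≤m+n _ _)) (trans (sym s≡0) e))
  ... | inj₁ (1≤i , i≤n) with sum-max (x≤a i 1≤i i≤n) (y≤a i 1≤i i≤n) (trans (sym (sum-at i 1≤i i≤n)) e)
  ...   | xᵢ≡a , yᵢ≡a = begin
    s (i ∸ 1)                 ≡⟨ uncurry (sum-at (i ∸ 1)) (pred-range i 2≤i i≤n) ⟩
    x (i ∸ 1) + y (i ∸ 1)     ≡⟨ cong₂ _+_ (x-max i 2≤i i≤n xᵢ≡a) (y-max i 2≤i i≤n yᵢ≡a) ⟩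
    0                         ∎
    where open ≡-Reasoning
  near-double⇒pred-bounded : ∀ i → 2 ≤ i → 2 * a i ≤ suc (s i) → s (i ∸ 1) ≤ a (i ∸ 1)
  near-double⇒pred-bounded i 2≤i h with sum-cases i
  ... | inj₂ s≡0 = ⊥-elim (<⇒≱ (+-mono-≤ (a-pos′ i 2≤i) (≤-trans (a-pos′ i 2≤i) (m≤m+n _ 0)))
                                (subst (λ t → 2 * a i ≤ suc t) s≡0 h))
  ... | inj₁ (1≤i , i≤n) rewrite uncurry (sum-at (i ∸ 1)) (pred-range i 2≤i i≤n)
      with sum-near-max (x≤a i 1≤i i≤n) (y≤a i 1≤i i≤n)
                        (subst (λ t → 2 * a i ≤ suc t) (sum-at i 1≤i i≤n) h)
  ...   | inj₁ xᵢ≡a rewrite x-max i 2≤i i≤n xᵢ≡a = uncurry (y≤a (i ∸ 1)) (pred-range i 2≤i i≤n)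
  ...   | inj₂ yᵢ≡a rewrite y-max i 2≤i i≤n yᵢ≡a | +-identityʳ (x (i ∸ 1)) =
    uncurry (x≤a (i ∸ 1)) (pred-range i 2≤i i≤n)
  first-slack : 2 + s 1 ≤ 2 * a 1
  first-slack rewrite sum-at 1 ≤-refl 1≤n | 2*-double (a 1) =
    subst (_≤ a 1 + a 1) (cong suc (+-suc (x 1) (y 1))) (+-mono-≤ (x₁<a₁ 1≤n) (y₁<a₁ 1≤n))

module _ (a : ℕ → ℕ) (a-pos : ∀ i → 1 ≤ i → 1 ≤ a i) (n′ : ℕ) (x y : Word) where
  open Bounds a
  open Value a
  open ValuePreservation a a-pos

  v3-value : val a (5 + n′) (v3 a (2 + n′) x y) ≡ val a (2 + n′) x + val a (2 + n′) y
  v3-value = begin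
    val a (5 + n′) (v3 a (2 + n′) x y)
      ≡⟨ runDown-val (5 + n′) (3 + n′) (trunc (4 + n′) (wFinal a (2 + n′) x y)) ≤-refl ⟩
    val a (5 + n′) (trunc (4 + n′) (wFinal a (2 + n′) x y))
      ≡⟨ val-trunc (4 + n′) 1 (wFinal a (2 + n′) x y) ⟩
    val a (4 + n′) (wFinal a (2 + n′) x y)
      ≡⟨ runUp-val (4 + n′) (2 + n′) (trunc (3 + n′) (z3 a (2 + n′) x y)) ≤-refl ⟩
    val a (4 + n′) (trunc (3 + n′) (z3 a (2 + n′) x y))
      ≡⟨ val-trunc (3 + n′) 1 (z3 a (2 + n′) x y) ⟩
    val a (3 + n′) (z3 a (2 + n′) x y)
      ≡⟨ alg1-val (3 + n′) n′ (sumWord (2 + n′) x y) ≤-refl ⟩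
    val a (3 + n′) (sumWord (2 + n′) x y)
      ≡⟨ val-trunc (2 + n′) 1 (λ i → x i + y i) ⟩
    val a (2 + n′) (λ i → x i + y i)
      ≡⟨ val-+ (2 + n′) x y ⟩
    val a (2 + n′) x + val a (2 + n′) y
      ∎
    where open ≡-Reasoning

  v3-ostrowski : IsOstrowski a (2 + n′) x → IsOstrowski a (2 + n′) y →
    IsOstrowski a (5 + n′) (v3 a (2 + n′) x y)
  v3-ostrowski ox oy =
    Pass3.invariant⇒ostrowski a a-pos (5 + n′) (v3 a (2 + n′) x y)
      (Pass3.runDown-invariant a a-pos (5 + n′) (3 + n′) (trunc (4 + n′) w) ≤-refl
        (Pass3.start a a-pos (3 + n′) w (Pass2.Invariant.bounded w-inv)
          (λ k 3≤k k≤3+n′ → Pass2.Invariant.no-valley w-inv k 3≤k (m≤n⇒m≤1+n k≤3+n′))))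
    where
    s w : Word
    s = sumWord (2 + n′) x y
    w = wFinal a (2 + n′) x y
    sc : Pass1.SumConditions a a-pos s (3 + n′)
    sc = sum-conditions a a-pos (2 + n′) x y (s≤s z≤n) ox oy
    z-bounded : BoundedUpTo (3 + n′) (z3 a (2 + n′) x y)
    z-bounded = Pass1.alg1-bounded a a-pos s (3 + n′) sc n′ s
                  (Pass1.start a a-pos s (3 + n′) sc n′ ≤-refl (Pass1.SumConditions.top-zero sc))
    w-inv : Pass2.Invariant a a-pos (4 + n′) w
    w-inv = Pass2.runUp-invariant a a-pos (2 + n′) (trunc (3 + n′) (z3 a (2 + n′) x y))
              (Pass2.start a a-pos (trunc (3 + n′) (z3 a (2 + n′) x y))
                (trunc-bounded (3 + n′) (z3 a (2 + n′) x y) (s≤s z≤n) z-bounded))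

mainTheorem10 : (a : ℕ → ℕ) → ((i : ℕ) → 1 ≤ i → 1 ≤ a i) →
    (n : ℕ) → 2 ≤ n → (x y : Word) → IsOstrowski a n x → IsOstrowski a n y →
    (M N : ℕ) → M ≡ val a n x → N ≡ val a n y →
    IsOstrowski a (suc (suc (suc n))) (v3 a n x y) ×
      (val a (suc (suc (suc n))) (v3 a n x y) ≡ M + N)
mainTheorem10 a a-pos (suc (suc n′)) (s≤s (s≤s _)) x y ox oy M N refl refl =
  v3-ostrowski a a-pos n′ x y ox oy , v3-value a a-pos n′ x y
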